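{- Fix a real number $q$ and let $L_q=qD+A$. Let $(H,B)$ be a coalescent pair, let $G$ be a graph rooted at $r$, let $\mathcal{G}$ be the graph obtained by coalescing $(H,B)$ with $G$, and let $T\subseteq V(H)$ with $T\cap B=\emptyset$ (regarded as a set of vertices of $\mathcal{G}$). Then \[ p_{\mathcal{G},T}(x)=\sum_{k=0}^{|B|}\bigg(\big(p_{G,r}(x)\big)^{|B|-k}\big(p_{G,\emptyset}(x)-x\,p_{G,r}(x)\big)^{k}\sum_{\substack{S\subseteq B\\|S|=k}}p_{H,S\cup T}(x)\bigg). \] In particular, taking $T=\emptyset$ gives the characteristic polynomial $p_{\mathcal{G}}(x)$ of $L_q(\mathcal{G})$.
   Context: All graphs are finite, simple and undirected. For a graph $F$, $D$ is the diagonal matrix of vertex degrees of $F$, $A$ its adjacency matrix, and $L_q(F)=qD+A$. For $S\subseteq V(F)$, $p_{F,S}(x)$ denotes the characteristic polynomial $\det(xI-M)$ of the matrix $M$ obtained from $L_q(F)$ by deleting the rows and columns indexed by $S$ (the diagonal entries of the remaining rows still use degrees in $F$); $p_{F,v}=p_{F,\{v\}}$ and $p_F=p_{F,\emptyset}$. A coalescent pair $(H,B)$ is a graph $H$ with $B\subseteq V(H)$; coalescing $(H,B)$ with a rooted graph $G$ (root $r$) means taking $|B|$ disjoint copies of $G$ and identifying the root of each copy with a different vertex of $B$. -}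

module Defs where

open import Level using (Level)
open import Algebra.Bundles using (CommutativeRing)
open import Data.Bool using (Bool; true; false; not; _∧_; _∨_; if_then_else_; T)
open import Data.Bool.Properties using (T?)
open import Data.Nat using (ℕ; zero; suc; _∸_)
open import Data.Fin using (Fin; zero; suc; punchIn)
open import Data.List using (List; []; _∷_; length; map; filter; filterᵇ; concatMap; _++_; lookup; upTo; foldr)
open import Data.Bool.ListAction using (any)
open import Data.List.Membership.Propositional using (_∈_)
open import Data.List.Relation.Unary.Unique.Propositional using (Unique)
open import Data.Sum using (_⊎_; inj₁; inj₂)
open import Data.Product using (_×_; _,_)
import Data.Sum.Properties as SumP
import Data.Product.Properties as ProdP
open import Relation.Nullary using (does)
open import Relation.Binary using (DecidableEquality)
open import Relation.Binary.PropositionalEquality using (_≡_)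
open import Data.Nat.Properties using () renaming (_≟_ to _≟ℕ_)

-- Finite (raw) graphs.  The vertex set of the graph is the list 'verts'
-- (carrier type V with decidable equality); 'adj' is the adjacency test.
-- Only adjacencies between listed vertices matter.

record Graph : Set₁ where
  field
    V     : Set
    _≟_   : DecidableEquality V
    verts : List V
    adj   : V → V → Bool

open Graph public

record IsSimple (F : Graph) : Set where
  field
    unique  : Unique (verts F)
    adj-sym : ∀ u v → adj F u v ≡ adj F v u
    adj-irr : ∀ v → adj F v v ≡ false

eqb : (F : Graph) → V F → V F → Bool
eqb F u v = does (_≟_ F u v)

deg : (F : Graph) → V F → ℕ
deg F v = length (filterᵇ (adj F v) (verts F))

keep : (F : Graph) → (V F → Bool) → List (V F)
keep F S = filterᵇ (λ v → not (S v)) (verts F)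

-- all sublists of a list (each subset of a duplicate-free list exactly once)
sublists : {A : Set} → List A → List (List A)
sublists []       = [] ∷ []
sublists (a ∷ as) = sublists as ++ map (a ∷_) (sublists as)

-- Vertices: inj₁ h for h ∈ V(H); inj₂ (b , v) for b ∈ B and v ∈ V(G) ∖ {r},
-- the copy of v in the copy of G attached at b (whose root is identified with b).

coalesce : (H : Graph) → (V H → Bool) → (G : Graph) → V G → Graph
coalesce H B G r = record
  { V     = V H ⊎ (V H × V G)
  ; _≟_   = SumP.≡-dec (_≟_ H) (ProdP.≡-dec (_≟_ H) (_≟_ G))
  ; verts = map inj₁ (verts H)
            ++ concatMap (λ b → map (λ v → inj₂ (b , v)) (filterᵇ (λ v → not (eqb G v r)) (verts G)))
                         (filterᵇ B (verts H))
  ; adj   = a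
  }
  where
  a : V H ⊎ (V H × V G) → V H ⊎ (V H × V G) → Bool
  a (inj₁ h)       (inj₁ h′)        = adj H h h′
  a (inj₁ h)       (inj₂ (b , v))   = eqb H h b ∧ adj G r v
  a (inj₂ (b , v)) (inj₁ h)         = eqb H h b ∧ adj G r v
  a (inj₂ (b , v)) (inj₂ (b′ , v′)) = eqb H b b′ ∧ adj G v v′

liftSet : (H : Graph) (G : Graph) → (V H → Bool) → V H ⊎ (V H × V G) → Bool
liftSet H G T (inj₁ h) = T h
liftSet H G T (inj₂ _) = false

module _ {c ℓ : Level} (R : CommutativeRing c ℓ) where
  open CommutativeRing R using (Carrier; _+_; _*_; -_; _-_; 0#; 1#)

  sumFin : (n : ℕ) → (Fin n → Carrier) → Carrier
  sumFin zero    f = 0#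
  sumFin (suc n) f = f zero + sumFin n (λ i → f (suc i))

  sumList : List Carrier → Carrier
  sumList = foldr _+_ 0#

  pow : Carrier → ℕ → Carrier
  pow a zero    = 1#
  pow a (suc n) = a * pow a n

  natR : ℕ → Carrier
  natR zero    = 0#
  natR (suc n) = 1# + natR n

  sgn : {n : ℕ} → Fin n → Carrier
  sgn zero    = 1#
  sgn (suc j) = - sgn j

  det : (n : ℕ) → (Fin n → Fin n → Carrier) → Carrier
  det zero    M = 1#
  det (suc n) M = sumFin (suc n) λ j →
    sgn j * (M zero j * det n (λ a b → M (suc a) (punchIn j b)))

  Lq : Carrier → (F : Graph) → V F → V F → Carrier
  Lq q F u v = if eqb F u v then q * natR (deg F u)
               else (if adj F u v then 1# else 0#)

  -- p_{F,S}(x) = det(xI - M), M = L_q(F) with rows/columns in S deleted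
  -- (diagonal entries still use degrees in F), evaluated at x.
  charPoly : Carrier → (F : Graph) → (V F → Bool) → Carrier → Carrier
  charPoly q F S x = det (length ks) λ i j →
      (if does (i Data.Fin.≟ j) then x else 0#) - Lq q F (lookup ks i) (lookup ks j)
    where ks = keep F S

  theorem3RHS : Carrier → (H : Graph) → (V H → Bool) → (G : Graph) → V G →
                (V H → Bool) → Carrier → Carrier
  theorem3RHS q H B G r T x =
    sumList (map (λ k →
        pow pGr (nB ∸ k) * (pow (pG - x * pGr) k *
          sumList (map (λ S → charPoly q H (λ v → any (eqb H v) S ∨ T v) x)
                       (filterᵇ (λ S → does (length S ≟ℕ k)) (sublists Bl)))))
      (upTo (suc nB)))
    where
    Bl  = filterᵇ B (verts H)
    nB  = length Bl
    pGr = charPoly q G (eqb G r) x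
    pG  = charPoly q G (λ _ → false) x

-- Write p_{𝒢,T} as the determinant of the submatrix of xI - L_q(𝒢) on the kept vertices and peel
-- off the attachment vertices b ∈ B one at a time. Splitting the row of b into its entries on the
-- copy of G - r glued at b and the rest decouples that copy: the determinant becomes
--   det(rest with b) · p_{G,r} + det(rest without b) · β,
-- where p_G = (x - q deg_G r) p_{G,r} + β is the expansion of p_G along the row of r.
-- The diagonal entry at b still carries the extra c₀ = -q deg_G r; removing it costs another
-- c₀ · det(rest without b). Hence b contributes p_{G,r} if it stays and β + c₀ p_{G,r} = p_G - x p_{G,r}
-- if it is deleted, and induction over B, grouping the deleted sets S by |S|, gives the formula.

module Submission where

open import Level using (Level; _⊔_)
open import Algebra.Bundles using (CommutativeRing)
open import Data.Bool using (Bool; true; false; not; _∧_; _∨_; if_then_else_; T)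
open import Data.Bool.ListAction using (any)
open import Data.Bool.Properties using (T?; ∧-zeroʳ; ∧-comm)
open import Data.Empty using (⊥)
open import Data.Fin as Fin using (Fin; zero; suc; punchIn)
open import Data.List using (List; []; _∷_; _++_; length; lookup; map; concatMap; filterᵇ; tabulate; upTo)
import Data.List.Properties as List
open import Data.List.Membership.Propositional using (_∈_; _∉_)
import Data.List.Membership.Propositional.Properties as ∈
open import Data.List.Relation.Unary.All as All using (All; []; _∷_)
import Data.List.Relation.Unary.All.Properties as All
open import Data.List.Relation.Unary.AllPairs using ([]; _∷_)
open import Data.List.Relation.Unary.Any using (here; there)
open import Data.List.Relation.Unary.Unique.Propositional using (Unique)
import Data.List.Relation.Unary.Unique.Propositional.Properties as Unique
open import Data.List.Relation.Binary.Permutation.Propositional as ↭ using (_↭_; ↭-sym; ↭-reflexive)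
import Data.List.Relation.Binary.Permutation.Propositional.Properties as ↭ₚ
open import Data.Nat as ℕ using (ℕ; zero; suc; _∸_; _≤_; z≤n; s≤s)
import Data.Nat.Properties as ℕₚ
open import Data.Product using (_×_; _,_; proj₁; proj₂; ∃; ∃₂)
import Data.Product.Properties as Product
open import Data.Sum using (_⊎_; inj₁; inj₂; [_,_]′)
import Data.Sum.Properties as Sum
open import Data.Unit using (tt)
open import Function using (_∘_)
open import Function.Bundles using (mk⇔)
open import Relation.Binary.Definitions using (DecidableEquality)
open import Relation.Binary.PropositionalEquality as ≡ using (_≡_; _≢_)
open import Relation.Nullary using (¬_; Dec; does; yes; no; contradiction)
open import Relation.Nullary.Decidable using (dec-true; dec-false; does-⇔)

open import Defs

not-∨ : ∀ a b → not (a ∨ b) ≡ not a ∧ not b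
not-∨ true  b = ≡.refl
not-∨ false b = ≡.refl

module _ {A : Set} where

  filterᵇ-cong : ∀ {p q : A → Bool} → (∀ x → p x ≡ q x) → ∀ xs → filterᵇ p xs ≡ filterᵇ q xs
  filterᵇ-cong p≗q []       = ≡.refl
  filterᵇ-cong {p} {q} p≗q (x ∷ xs) with p x | q x | p≗q x
  ... | true  | true  | _ = ≡.cong (x ∷_) (filterᵇ-cong p≗q xs)
  ... | false | false | _ = filterᵇ-cong p≗q xs

  filterᵇ-filterᵇ : ∀ (p q : A → Bool) xs → filterᵇ p (filterᵇ q xs) ≡ filterᵇ (λ x → q x ∧ p x) xs
  filterᵇ-filterᵇ p q []       = ≡.refl
  filterᵇ-filterᵇ p q (x ∷ xs) with q x
  ... | false = filterᵇ-filterᵇ p q xs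
  ... | true with p x
  ...   | true  = ≡.cong (x ∷_) (filterᵇ-filterᵇ p q xs)
  ...   | false = filterᵇ-filterᵇ p q xs

  filterᵇ-map : ∀ {B : Set} (p : A → Bool) (f : B → A) xs → filterᵇ p (map f xs) ≡ map f (filterᵇ (λ x → p (f x)) xs)
  filterᵇ-map p f []       = ≡.refl
  filterᵇ-map p f (x ∷ xs) with p (f x)
  ... | true  = ≡.cong (f x ∷_) (filterᵇ-map p f xs)
  ... | false = filterᵇ-map p f xs

  length-filterᵇ-map : ∀ {B : Set} (p : A → Bool) (f : B → A) xs →
    length (filterᵇ p (map f xs)) ≡ length (filterᵇ (λ x → p (f x)) xs)
  length-filterᵇ-map p f xs = ≡.trans (≡.cong length (filterᵇ-map p f xs)) (List.length-map f (filterᵇ (λ x → p (f x)) xs))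

  length-filterᵇ-++ : ∀ (p : A → Bool) xs ys →
    length (filterᵇ p (xs ++ ys)) ≡ length (filterᵇ p xs) ℕ.+ length (filterᵇ p ys)
  length-filterᵇ-++ p xs ys = ≡.trans (≡.cong length (List.filter-++ (T? ∘ p) xs ys)) (List.length-++ (filterᵇ p xs))

  filterᵇ-false : ∀ (xs : List A) → filterᵇ (λ _ → false) xs ≡ []
  filterᵇ-false []       = ≡.refl
  filterᵇ-false (x ∷ xs) = filterᵇ-false xs

  length-filterᵇ-∧ : ∀ t (p : A → Bool) xs →
    length (filterᵇ (λ x → t ∧ p x) xs) ≡ (if t then length (filterᵇ p xs) else 0)
  length-filterᵇ-∧ true  p xs = ≡.refl
  length-filterᵇ-∧ false p xs = ≡.cong length (filterᵇ-false xs)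

  Unique-lookup-injective : ∀ {xs : List A} → Unique xs → ∀ i j → lookup xs i ≡ lookup xs j → i ≡ j
  Unique-lookup-injective (_ ∷ _)      zero    zero    _ = ≡.refl
  Unique-lookup-injective (x≢xs ∷ _)   zero    (suc j) x≡ = contradiction x≡ (All.lookup x≢xs (∈.∈-lookup j))
  Unique-lookup-injective (x≢xs ∷ _)   (suc i) zero    ≡x = contradiction (≡.sym ≡x) (All.lookup x≢xs (∈.∈-lookup i))
  Unique-lookup-injective (_ ∷ xs!)    (suc i) (suc j) ≡′ = ≡.cong suc (Unique-lookup-injective xs! i j ≡′)

module DecidableLists {A : Set} (_≟_ : DecidableEquality A) where

  does-≟-sym : ∀ u v → does (u ≟ v) ≡ does (v ≟ u)
  does-≟-sym u v = does-⇔ (mk⇔ ≡.sym ≡.sym) (u ≟ v) (v ≟ u)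

  _∈ᵇ_ : A → List A → Bool
  v ∈ᵇ S = any (λ s → does (v ≟ s)) S

  ∈ᵇ-true : ∀ {v S} → v ∈ S → v ∈ᵇ S ≡ true
  ∈ᵇ-true {v} (here ≡.refl) rewrite dec-true (v ≟ v) ≡.refl = ≡.refl
  ∈ᵇ-true {v} {s ∷ S} (there v∈S) rewrite ∈ᵇ-true v∈S with does (v ≟ s)
  ... | true  = ≡.refl
  ... | false = ≡.refl

  ∈ᵇ-false : ∀ {v S} → v ∉ S → v ∈ᵇ S ≡ false
  ∈ᵇ-false {v} {[]}    v∉S = ≡.refl
  ∈ᵇ-false {v} {s ∷ S} v∉S rewrite dec-false (v ≟ s) (λ v≡s → v∉S (here v≡s)) =
    ∈ᵇ-false (λ v∈S → v∉S (there v∈S))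

  remove : A → List A → List A
  remove b = filterᵇ (λ v → not (does (v ≟ b)))

  module _ {b u : A} where

    T-not-does⇒≢ : T (not (does (u ≟ b))) → u ≢ b
    T-not-does⇒≢ t with u ≟ b
    ... | no u≢b = u≢b

    ≢⇒T-not-does : u ≢ b → T (not (does (u ≟ b)))
    ≢⇒T-not-does u≢b rewrite dec-false (u ≟ b) u≢b = tt

    remove-⊆ : ∀ {xs} → u ∈ remove b xs → u ∈ xs
    remove-⊆ {xs} u∈ = proj₁ (∈.∈-filter⁻ (λ v → T? (not (does (v ≟ b)))) {xs = xs} u∈)

    remove-≢ : ∀ {xs} → u ∈ remove b xs → u ≢ b
    remove-≢ {xs} u∈ = T-not-does⇒≢ (proj₂ (∈.∈-filter⁻ (λ v → T? (not (does (v ≟ b)))) {xs = xs} u∈))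

    ∈-remove : ∀ {xs} → u ∈ xs → u ≢ b → u ∈ remove b xs
    ∈-remove u∈ u≢b = ∈.∈-filter⁺ (λ v → T? (not (does (v ≟ b)))) u∈ (≢⇒T-not-does u≢b)

  ∉-remove : ∀ b xs → b ∉ remove b xs
  ∉-remove b xs b∈ = remove-≢ {xs = xs} b∈ ≡.refl

  ↭-remove : ∀ {b} xs → Unique xs → b ∈ xs → xs ↭ b ∷ remove b xs
  ↭-remove (x ∷ xs) (x≢xs ∷ _) (here ≡.refl) rewrite dec-true (x ≟ x) ≡.refl =
    ↭.prep x (↭-reflexive (≡.sym (List.filter-all (λ v → T? (not (does (v ≟ x))))
      (All.map (λ x≢v → ≢⇒T-not-does (λ v≡x → x≢v (≡.sym v≡x))) x≢xs))))
  ↭-remove {b} (x ∷ xs) (x≢xs ∷ xs!) (there b∈xs) rewrite dec-false (x ≟ b) (λ x≡b → All.lookup x≢xs b∈xs x≡b) =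
    ↭.trans (↭.prep x (↭-remove xs xs! b∈xs)) (↭.swap x b ↭.refl)

  length-filterᵇ-≟ : ∀ {b} xs → Unique xs → b ∈ xs → length (filterᵇ (λ x → does (x ≟ b)) xs) ≡ 1
  length-filterᵇ-≟ {b} xs xs! b∈xs = begin
    length (filterᵇ is-b xs)                  ≡⟨ ↭ₚ.↭-length (↭ₚ.filter-↭ (T? ∘ is-b) (↭-remove xs xs! b∈xs)) ⟩
    length (filterᵇ is-b (b ∷ remove b xs))   ≡⟨ ≡.cong length (List.filter-accept (T? ∘ is-b) b≟b) ⟩
    suc (length (filterᵇ is-b (remove b xs))) ≡⟨ ≡.cong (suc ∘ length) (List.filter-none (T? ∘ is-b) others) ⟩
    1                                         ∎
    where
    open ≡.≡-Reasoning
    is-b : A → Bool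
    is-b x = does (x ≟ b)
    b≟b : T (does (b ≟ b))
    b≟b = ≡.subst T (≡.sym (dec-true (b ≟ b) ≡.refl)) tt
    others : All (λ x → ¬ T (does (x ≟ b))) (remove b xs)
    others = All.tabulate λ {x} x∈ → ≡.subst T (dec-false (x ≟ b) (remove-≢ {xs = xs} x∈))

open DecidableLists public

data Pick {V : Set} (v : V) : List V → List V → Set where
  first : ∀ {vs} → Pick v (v ∷ vs) vs
  skip  : ∀ {u vs ws} → Pick v vs ws → Pick v (u ∷ vs) (u ∷ ws)

module _ {V : Set} {v : V} where

  Pick-∈ : ∀ {vs ws} → Pick v vs ws → v ∈ vs
  Pick-∈ first    = here ≡.refl
  Pick-∈ (skip p) = there (Pick-∈ p)

  Pick-⊆ : ∀ {vs ws u} → Pick v vs ws → u ∈ ws → u ∈ vs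
  Pick-⊆ first    u∈ws         = there u∈ws
  Pick-⊆ (skip p) (here u≡)    = here u≡
  Pick-⊆ (skip p) (there u∈ws) = there (Pick-⊆ p u∈ws)

  Pick-length : ∀ {vs ws} → Pick v vs ws → length vs ≡ suc (length ws)
  Pick-length first    = ≡.refl
  Pick-length (skip p) = ≡.cong suc (Pick-length p)

module RingLemmas {c ℓ : Level} (R : CommutativeRing c ℓ) where

  open CommutativeRing R
  open import Algebra.Properties.Ring ring
  open import Relation.Binary.Reasoning.Setoid setoid

  x-0#≈x : ∀ x → x - 0# ≈ x
  x-0#≈x x = trans (+-congˡ -0#≈0#) (+-identityʳ x)

  [x+y]-[z+w]≈[x-z]+[y-w] : ∀ x y z w → (x + y) - (z + w) ≈ (x - z) + (y - w)
  [x+y]-[z+w]≈[x-z]+[y-w] x y z w = begin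
    (x + y) + - (z + w)   ≈⟨ +-congˡ (-‿+-comm z w) ⟨
    (x + y) + (- z + - w) ≈⟨ +-assoc x y (- z + - w) ⟩
    x + (y + (- z + - w)) ≈⟨ +-congˡ (+-assoc y (- z) (- w)) ⟨
    x + ((y + - z) + - w) ≈⟨ +-congˡ (+-congʳ (+-comm y (- z))) ⟩
    x + ((- z + y) + - w) ≈⟨ +-congˡ (+-assoc (- z) y (- w)) ⟩
    x + (- z + (y - w))   ≈⟨ +-assoc x (- z) (y - w) ⟨
    (x - z) + (y - w)     ∎

  x-[y-z]≈[x+z]-y : ∀ x y z → x - (y - z) ≈ (x + z) - y
  x-[y-z]≈[x+z]-y x y z = begin
    x + - (y - z) ≈⟨ +-congˡ (⁻¹-anti-homo‿- y z) ⟩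
    x + (z - y)   ≈⟨ +-assoc x z (- y) ⟨
    (x + z) - y   ∎

  [-x]-[-y]≈-[x-y] : ∀ x y → - x - - y ≈ - (x - y)
  [-x]-[-y]≈-[x-y] x y = -‿+-comm x (- y)

  x*[y*z]≈y*[x*z] : ∀ x y z → x * (y * z) ≈ y * (x * z)
  x*[y*z]≈y*[x*z] x y z = begin
    x * (y * z) ≈⟨ *-assoc x y z ⟨
    (x * y) * z ≈⟨ *-congʳ (*-comm x y) ⟩
    (y * x) * z ≈⟨ *-assoc y x z ⟩
    y * (x * z) ∎

module Minors {c ℓ : Level} (R : CommutativeRing c ℓ) where

  open CommutativeRing R renaming (Carrier to C) hiding (zero)
  open import Algebra.Properties.Ring ring
  open import Relation.Binary.Reasoning.Setoid setoid

  open RingLemmas R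

  -- laplace h [c₀, …, cₙ] = Σᵢ (-1)ⁱ h cᵢ [c₀, …, cᵢ₋₁, cᵢ₊₁, …, cₙ]
  laplace : {V : Set} → (V → List V → C) → List V → C
  laplace h []       = 0#
  laplace h (c ∷ cs) = h c cs - laplace (λ d ds → h d (c ∷ ds)) cs

  -- The determinant of the submatrix of M on rows rs and columns cs (0 if their lengths differ).
  minor : {V : Set} → (V → V → C) → List V → List V → C
  minor M []       []      = 1#
  minor M []       (_ ∷ _) = 0#
  minor M (r ∷ rs) cs      = laplace (λ c cs′ → M r c * minor M rs cs′) cs

  module _ {V : Set} where

    laplace-cong-∈ : ∀ {h h′ : V → List V → C} cs →
      (∀ c cs′ → Pick c cs cs′ → h c cs′ ≈ h′ c cs′) → laplace h cs ≈ laplace h′ cs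
    laplace-cong-∈ []       h≈h′ = refl
    laplace-cong-∈ (c ∷ cs) h≈h′ =
      +-cong (h≈h′ c cs first) (-‿cong (laplace-cong-∈ cs λ d ds p → h≈h′ d (c ∷ ds) (skip p)))

    laplace-cong : ∀ {h h′ : V → List V → C} cs →
      (∀ c cs′ → h c cs′ ≈ h′ c cs′) → laplace h cs ≈ laplace h′ cs
    laplace-cong cs h≈h′ = laplace-cong-∈ cs λ c cs′ _ → h≈h′ c cs′

    laplace-0# : ∀ cs → laplace {V} (λ _ _ → 0#) cs ≈ 0#
    laplace-0# []       = refl
    laplace-0# (c ∷ cs) = trans (+-congˡ (-‿cong (laplace-0# cs))) (x-0#≈x 0#)

    laplace-+ : ∀ (h g : V → List V → C) cs →
      laplace (λ c cs′ → h c cs′ + g c cs′) cs ≈ laplace h cs + laplace g cs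
    laplace-+ h g []       = sym (+-identityʳ 0#)
    laplace-+ h g (c ∷ cs) = trans (+-congˡ (-‿cong (laplace-+ _ _ cs))) ([x+y]-[z+w]≈[x-z]+[y-w] _ _ _ _)

    laplace-*ˡ : ∀ k (h : V → List V → C) cs →
      laplace (λ c cs′ → k * h c cs′) cs ≈ k * laplace h cs
    laplace-*ˡ k h []       = sym (zeroʳ k)
    laplace-*ˡ k h (c ∷ cs) = trans (+-congˡ (-‿cong (laplace-*ˡ k _ cs))) (sym (x[y-z]≈xy-xz k _ _))

    laplace-*ʳ : ∀ k (h : V → List V → C) cs →
      laplace (λ c cs′ → h c cs′ * k) cs ≈ laplace h cs * k
    laplace-*ʳ k h cs = begin
      laplace (λ c cs′ → h c cs′ * k) cs ≈⟨ laplace-cong cs (λ c cs′ → *-comm (h c cs′) k) ⟩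
      laplace (λ c cs′ → k * h c cs′) cs ≈⟨ laplace-*ˡ k h cs ⟩
      k * laplace h cs                   ≈⟨ *-comm k _ ⟩
      laplace h cs * k                   ∎

    laplace-neg : ∀ (h : V → List V → C) cs →
      laplace (λ c cs′ → - h c cs′) cs ≈ - laplace h cs
    laplace-neg h []       = sym -0#≈0#
    laplace-neg h (c ∷ cs) = trans (+-congˡ (-‿cong (laplace-neg _ cs))) ([-x]-[-y]≈-[x-y] _ _)

    laplace-++ : ∀ (h : V → List V → C) cs ys → (∀ y ds → y ∈ ys → h y ds ≈ 0#) →
      laplace h (cs ++ ys) ≈ laplace (λ c cs′ → h c (cs′ ++ ys)) cs
    laplace-++ h []       ys h≈0 =
      trans (laplace-cong-∈ ys (λ y ds p → h≈0 y ds (Pick-∈ p))) (laplace-0# ys)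
    laplace-++ h (c ∷ cs) ys h≈0 =
      +-congˡ (-‿cong (laplace-++ _ cs ys (λ y ds → h≈0 y (c ∷ ds))))

    minor-cong : ∀ {M M′ : V → V → C} rs cs →
      (∀ u v → u ∈ rs → v ∈ cs → M u v ≈ M′ u v) → minor M rs cs ≈ minor M′ rs cs
    minor-cong []       []      M≈M′ = refl
    minor-cong []       (_ ∷ _) M≈M′ = refl
    minor-cong (r ∷ rs) cs      M≈M′ = laplace-cong-∈ cs λ c cs′ p →
      *-cong (M≈M′ r c (here ≡.refl) (Pick-∈ p))
             (minor-cong rs cs′ λ u v u∈ v∈ → M≈M′ u v (there u∈) (Pick-⊆ p v∈))

    minor-≡ : ∀ (M : V → V → C) {vs ws} → vs ≡ ws → minor M vs vs ≈ minor M ws ws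
    minor-≡ M ≡.refl = refl

    minor-++-triangular : ∀ (M : V → V → C) rs cs ys → length rs ≡ length cs →
      (∀ r y → r ∈ rs → y ∈ ys → M r y ≈ 0#) →
      minor M (rs ++ ys) (cs ++ ys) ≈ minor M rs cs * minor M ys ys
    minor-++-triangular M []       []      ys _   _   = sym (*-identityˡ _)
    minor-++-triangular M (r ∷ rs) cs      ys |rs|≡|cs| M≈0 = begin
      laplace (λ c cs′ → M r c * minor M (rs ++ ys) cs′) (cs ++ ys)
        ≈⟨ laplace-++ _ cs ys (λ y _ y∈ → trans (*-congʳ (M≈0 r y (here ≡.refl) y∈)) (zeroˡ _)) ⟩
      laplace (λ c cs′ → M r c * minor M (rs ++ ys) (cs′ ++ ys)) cs
        ≈⟨ laplace-cong-∈ cs (λ c cs′ p → *-congˡ (minor-++-triangular M rs cs′ ys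
             (ℕₚ.suc-injective (≡.trans |rs|≡|cs| (Pick-length p))) (λ r′ y r′∈ → M≈0 r′ y (there r′∈)))) ⟩
      laplace (λ c cs′ → M r c * (minor M rs cs′ * minor M ys ys)) cs
        ≈⟨ laplace-cong cs (λ c cs′ → sym (*-assoc _ _ _)) ⟩
      laplace (λ c cs′ → (M r c * minor M rs cs′) * minor M ys ys) cs
        ≈⟨ laplace-*ʳ _ _ cs ⟩
      minor M (r ∷ rs) cs * minor M ys ys ∎

    laplace² : (V → V → List V → C) → List V → C
    laplace² g = laplace (λ c cs′ → laplace (g c) cs′)

    laplace²-cong : ∀ {g g′ : V → V → List V → C} cs →
      (∀ a b es → g a b es ≈ g′ a b es) → laplace² g cs ≈ laplace² g′ cs
    laplace²-cong cs g≈g′ = laplace-cong cs λ c cs′ → laplace-cong cs′ (g≈g′ c)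

    laplace²-∷ : ∀ (g : V → V → List V → C) c cs →
      laplace² g (c ∷ cs) ≈
      (laplace (g c) cs + laplace² (λ d e es → g d e (c ∷ es)) cs) - laplace (λ d ds → g d c ds) cs
    laplace²-∷ g c cs = begin
      laplace (g c) cs - laplace (λ d ds → g d c ds - laplace (λ e es → g d e (c ∷ es)) ds) cs
        ≈⟨ +-congˡ (-‿cong (laplace-+ _ _ cs)) ⟩
      laplace (g c) cs - (laplace (λ d ds → g d c ds) cs + laplace (λ d ds → - laplace (λ e es → g d e (c ∷ es)) ds) cs)
        ≈⟨ +-congˡ (-‿cong (+-congˡ (laplace-neg _ cs))) ⟩
      laplace (g c) cs - (laplace (λ d ds → g d c ds) cs - laplace² (λ d e es → g d e (c ∷ es)) cs)
        ≈⟨ x-[y-z]≈[x+z]-y _ _ _ ⟩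
      (laplace (g c) cs + laplace² (λ d e es → g d e (c ∷ es)) cs) - laplace (λ d ds → g d c ds) cs ∎

    laplace²-flip : ∀ cs (g : V → V → List V → C) → laplace² g cs ≈ - laplace² (λ a b → g b a) cs
    laplace²-flip []       g = sym -0#≈0#
    laplace²-flip (c ∷ cs) g = begin
      laplace² g (c ∷ cs)                      ≈⟨ laplace²-∷ g c cs ⟩
      (X + laplace² g↑ cs) - Y                 ≈⟨ ⁻¹-anti-homo‿- Y (X + laplace² g↑ cs) ⟨
      - (Y - (X + laplace² g↑ cs))             ≈⟨ -‿cong (+-congˡ (-‿cong (+-congˡ g↑≈))) ⟩
      - (Y - (X - laplace² g↑ᵀ cs))            ≈⟨ -‿cong (x-[y-z]≈[x+z]-y Y X _) ⟩
      - ((Y + laplace² g↑ᵀ cs) - X)            ≈⟨ -‿cong (laplace²-∷ (λ a b → g b a) c cs) ⟨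
      - laplace² (λ a b → g b a) (c ∷ cs)      ∎
      where
      X = laplace (g c) cs
      Y = laplace (λ d ds → g d c ds) cs
      g↑ g↑ᵀ : V → V → List V → C
      g↑ d e es = g d e (c ∷ es)
      g↑ᵀ d e es = g e d (c ∷ es)
      g↑≈ : laplace² g↑ cs ≈ - laplace² g↑ᵀ cs
      g↑≈ = laplace²-flip cs g↑

    minor-swapRows : ∀ (M : V → V → C) ps a b rs cs →
      minor M (ps ++ a ∷ b ∷ rs) cs ≈ - minor M (ps ++ b ∷ a ∷ rs) cs
    minor-swapRows M (p ∷ ps) a b rs cs = begin
      laplace (λ c cs′ → M p c * minor M (ps ++ a ∷ b ∷ rs) cs′) cs
        ≈⟨ laplace-cong cs (λ c cs′ → trans (*-congˡ (minor-swapRows M ps a b rs cs′)) (sym (-‿distribʳ-* _ _))) ⟩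
      laplace (λ c cs′ → - (M p c * minor M (ps ++ b ∷ a ∷ rs) cs′)) cs
        ≈⟨ laplace-neg _ cs ⟩
      - minor M ((p ∷ ps) ++ b ∷ a ∷ rs) cs ∎
    minor-swapRows M [] a b rs cs = begin
      minor M (a ∷ b ∷ rs) cs
        ≈⟨ laplace-cong cs (λ c cs′ → sym (laplace-*ˡ _ _ cs′)) ⟩
      laplace² (λ c₁ c₂ cs′ → M a c₁ * (M b c₂ * minor M rs cs′)) cs
        ≈⟨ laplace²-flip cs _ ⟩
      - laplace² (λ c₁ c₂ cs′ → M a c₂ * (M b c₁ * minor M rs cs′)) cs
        ≈⟨ -‿cong (laplace²-cong cs (λ c₁ c₂ cs′ → x*[y*z]≈y*[x*z] _ _ _)) ⟩
      - laplace² (λ c₁ c₂ cs′ → M b c₁ * (M a c₂ * minor M rs cs′)) cs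
        ≈⟨ -‿cong (laplace-cong cs (λ c cs′ → laplace-*ˡ _ _ cs′)) ⟩
      - minor M (b ∷ a ∷ rs) cs ∎

    laplace-swap : ∀ ps (a b : V) rs (h : V → List V → C) →
      (∀ c ps′ rs′ → h c (ps′ ++ a ∷ b ∷ rs′) ≈ - h c (ps′ ++ b ∷ a ∷ rs′)) →
      laplace h (ps ++ a ∷ b ∷ rs) ≈ - laplace h (ps ++ b ∷ a ∷ rs)
    laplace-swap [] a b rs h h-anti = begin
      h a (b ∷ rs) - (h b (a ∷ rs) - X) ≈⟨ x-[y-z]≈[x+z]-y _ _ _ ⟩
      (h a (b ∷ rs) + X) - h b (a ∷ rs) ≈⟨ +-congʳ (+-congˡ X≈) ⟩
      (h a (b ∷ rs) - Y) - h b (a ∷ rs) ≈⟨ ⁻¹-anti-homo‿- _ _ ⟨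
      - (h b (a ∷ rs) - (h a (b ∷ rs) - Y)) ∎
      where
      X = laplace (λ d ds → h d (a ∷ b ∷ ds)) rs
      Y = laplace (λ d ds → h d (b ∷ a ∷ ds)) rs
      X≈ : X ≈ - Y
      X≈ = trans (laplace-cong rs (λ d ds → h-anti d [] ds)) (laplace-neg _ rs)
    laplace-swap (p ∷ ps) a b rs h h-anti = begin
      h p (ps ++ a ∷ b ∷ rs) - laplace (λ d ds → h d (p ∷ ds)) (ps ++ a ∷ b ∷ rs)
        ≈⟨ +-cong (h-anti p ps rs) (-‿cong (laplace-swap ps a b rs _ (λ c ps′ rs′ → h-anti c (p ∷ ps′) rs′))) ⟩
      - h p (ps ++ b ∷ a ∷ rs) - - laplace (λ d ds → h d (p ∷ ds)) (ps ++ b ∷ a ∷ rs)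
        ≈⟨ [-x]-[-y]≈-[x-y] _ _ ⟩
      - laplace h ((p ∷ ps) ++ b ∷ a ∷ rs) ∎

    minor-swapColumns : ∀ (M : V → V → C) rs ps a b cs →
      minor M rs (ps ++ a ∷ b ∷ cs) ≈ - minor M rs (ps ++ b ∷ a ∷ cs)
    minor-swapColumns M []       []      a b cs = sym -0#≈0#
    minor-swapColumns M []       (_ ∷ _) a b cs = sym -0#≈0#
    minor-swapColumns M (r ∷ rs) ps      a b cs = laplace-swap ps a b cs _ λ c ps′ cs′ →
      trans (*-congˡ (minor-swapColumns M rs ps′ a b cs′)) (sym (-‿distribʳ-* _ _))

    minor-swap : ∀ (M : V → V → C) ps a b rs →
      minor M (ps ++ a ∷ b ∷ rs) (ps ++ a ∷ b ∷ rs) ≈ minor M (ps ++ b ∷ a ∷ rs) (ps ++ b ∷ a ∷ rs)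
    minor-swap M ps a b rs = begin
      minor M (ps ++ a ∷ b ∷ rs) (ps ++ a ∷ b ∷ rs)     ≈⟨ minor-swapRows M ps a b rs _ ⟩
      - minor M (ps ++ b ∷ a ∷ rs) (ps ++ a ∷ b ∷ rs)   ≈⟨ -‿cong (minor-swapColumns M (ps ++ b ∷ a ∷ rs) ps a b rs) ⟩
      - - minor M (ps ++ b ∷ a ∷ rs) (ps ++ b ∷ a ∷ rs) ≈⟨ -‿involutive _ ⟩
      minor M (ps ++ b ∷ a ∷ rs) (ps ++ b ∷ a ∷ rs)     ∎

    minor-++-↭ : ∀ (M : V → V → C) ps {vs ws} → vs ↭ ws →
      minor M (ps ++ vs) (ps ++ vs) ≈ minor M (ps ++ ws) (ps ++ ws)
    minor-++-↭ M ps ↭.refl = refl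
    minor-++-↭ M ps {a ∷ vs} {a ∷ ws} (↭.prep a vs↭ws) = begin
      minor M (ps ++ a ∷ vs) (ps ++ a ∷ vs)
        ≈⟨ minor-≡ M (≡.sym (List.++-assoc ps (a ∷ []) vs)) ⟩
      minor M ((ps ++ a ∷ []) ++ vs) ((ps ++ a ∷ []) ++ vs)
        ≈⟨ minor-++-↭ M (ps ++ a ∷ []) vs↭ws ⟩
      minor M ((ps ++ a ∷ []) ++ ws) ((ps ++ a ∷ []) ++ ws)
        ≈⟨ minor-≡ M (List.++-assoc ps (a ∷ []) ws) ⟩
      minor M (ps ++ a ∷ ws) (ps ++ a ∷ ws) ∎
    minor-++-↭ M ps {a ∷ b ∷ vs} {b ∷ a ∷ ws} (↭.swap a b vs↭ws) = begin
      minor M (ps ++ a ∷ b ∷ vs) (ps ++ a ∷ b ∷ vs)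
        ≈⟨ minor-swap M ps a b vs ⟩
      minor M (ps ++ b ∷ a ∷ vs) (ps ++ b ∷ a ∷ vs)
        ≈⟨ minor-≡ M (≡.sym (List.++-assoc ps (b ∷ a ∷ []) vs)) ⟩
      minor M ((ps ++ b ∷ a ∷ []) ++ vs) ((ps ++ b ∷ a ∷ []) ++ vs)
        ≈⟨ minor-++-↭ M (ps ++ b ∷ a ∷ []) vs↭ws ⟩
      minor M ((ps ++ b ∷ a ∷ []) ++ ws) ((ps ++ b ∷ a ∷ []) ++ ws)
        ≈⟨ minor-≡ M (List.++-assoc ps (b ∷ a ∷ []) ws) ⟩
      minor M (ps ++ b ∷ a ∷ ws) (ps ++ b ∷ a ∷ ws) ∎
    minor-++-↭ M ps (↭.trans vs↭us us↭ws) = trans (minor-++-↭ M ps vs↭us) (minor-++-↭ M ps us↭ws)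

    minor-↭ : ∀ (M : V → V → C) {vs ws} → vs ↭ ws → minor M vs vs ≈ minor M ws ws
    minor-↭ M = minor-++-↭ M []

    border : (V → V → C) → V → List V → C
    border M b vs = - laplace (λ d ds → M b d * minor M vs (b ∷ ds)) vs

    minor-∷ : ∀ (M : V → V → C) b vs → minor M (b ∷ vs) (b ∷ vs) ≈ M b b * minor M vs vs + border M b vs
    minor-∷ M b vs = refl

    border-cong : ∀ {M M′ : V → V → C} b vs → (∀ v → v ∈ vs → M b v ≈ M′ b v) →
      (∀ u v → u ∈ vs → v ∈ b ∷ vs → M u v ≈ M′ u v) → border M b vs ≈ border M′ b vs
    border-cong b vs M≈M′ᵇ M≈M′ = -‿cong (laplace-cong-∈ vs λ d ds p →
      *-cong (M≈M′ᵇ d (Pick-∈ p)) (minor-cong vs (b ∷ ds) λ u v u∈ v∈ → M≈M′ u v u∈ (∈-b∷ p v∈)))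
      where
      ∈-b∷ : ∀ {d ds v} → Pick d vs ds → v ∈ b ∷ ds → v ∈ b ∷ vs
      ∈-b∷ p (here v≡)    = here v≡
      ∈-b∷ p (there v∈ds) = there (Pick-⊆ p v∈ds)

    minor-shiftDiagonal : ∀ (M M′ : V → V → C) b vs k →
      (∀ u v → u ∈ vs → M u v ≈ M′ u v) → (∀ v → v ∈ vs → M b v ≈ M′ b v) → M b b ≈ M′ b b + k →
      minor M (b ∷ vs) (b ∷ vs) ≈ minor M′ (b ∷ vs) (b ∷ vs) + k * minor M vs vs
    minor-shiftDiagonal M M′ b vs k M≈M′ M≈M′ᵇ Mbb≈ = begin
      M b b * minor M vs vs + border M b vs
        ≈⟨ +-cong (*-congʳ Mbb≈) (border-cong b vs M≈M′ᵇ (λ u v u∈ _ → M≈M′ u v u∈)) ⟩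
      (M′ b b + k) * minor M vs vs + border M′ b vs
        ≈⟨ +-congʳ (distribʳ _ _ _) ⟩
      (M′ b b * minor M vs vs + k * minor M vs vs) + border M′ b vs
        ≈⟨ +-assoc _ _ _ ⟩
      M′ b b * minor M vs vs + (k * minor M vs vs + border M′ b vs)
        ≈⟨ +-congˡ (+-comm _ _) ⟩
      M′ b b * minor M vs vs + (border M′ b vs + k * minor M vs vs)
        ≈⟨ +-assoc _ _ _ ⟨
      (M′ b b * minor M vs vs + border M′ b vs) + k * minor M vs vs
        ≈⟨ +-congʳ (+-congʳ (*-congˡ (minor-cong vs vs (λ u v u∈ _ → M≈M′ u v u∈)))) ⟩
      minor M′ (b ∷ vs) (b ∷ vs) + k * minor M vs vs ∎

  module _ {V W : Set} (f : W → V) where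

    laplace-map : ∀ (h : V → List V → C) cs →
      laplace h (map f cs) ≈ laplace (λ c cs′ → h (f c) (map f cs′)) cs
    laplace-map h []       = refl
    laplace-map h (c ∷ cs) = +-congˡ (-‿cong (laplace-map _ cs))

    minor-map : ∀ (M : V → V → C) rs cs →
      minor M (map f rs) (map f cs) ≈ minor (λ u v → M (f u) (f v)) rs cs
    minor-map M []       []      = refl
    minor-map M []       (_ ∷ _) = refl
    minor-map M (r ∷ rs) cs      =
      trans (laplace-map _ cs) (laplace-cong cs λ c cs′ → *-congˡ (minor-map M rs cs′))

    border-map : ∀ (M : V → V → C) b vs →
      border M (f b) (map f vs) ≈ border (λ u v → M (f u) (f v)) b vs
    border-map M b vs =
      -‿cong (trans (laplace-map _ vs) (laplace-cong vs λ d ds → *-congˡ (minor-map M vs (b ∷ ds))))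

  module _ {V : Set} (_≟_ : DecidableEquality V) where
    open import Data.List.Membership.DecPropositional _≟_ using (_∈?_)

    setRow : V → (V → C) → (V → V → C) → V → V → C
    setRow b ρ M u = if does (u ≟ b) then ρ else M u

    setRow-at : ∀ b ρ M v → setRow b ρ M b v ≡ ρ v
    setRow-at b ρ M v rewrite dec-true (b ≟ b) ≡.refl = ≡.refl

    setRow-away : ∀ {b u} ρ M v → u ≢ b → setRow b ρ M u v ≡ M u v
    setRow-away {b} {u} ρ M v u≢b rewrite dec-false (u ≟ b) u≢b = ≡.refl

    minor-setRow-away : ∀ {b} ρ M rs cs → b ∉ rs → minor (setRow b ρ M) rs cs ≈ minor M rs cs
    minor-setRow-away ρ M rs cs b∉rs = minor-cong rs cs λ u v u∈ _ →
      reflexive (setRow-away ρ M v λ { ≡.refl → b∉rs u∈ })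

    minor-setRow : ∀ b ρ M vs cs → b ∉ vs →
      minor (setRow b ρ M) (b ∷ vs) cs ≈ laplace (λ c cs′ → ρ c * minor M vs cs′) cs
    minor-setRow b ρ M vs cs b∉vs = laplace-cong cs λ c cs′ →
      *-cong (reflexive (setRow-at b ρ M c)) (minor-setRow-away ρ M vs cs′ b∉vs)

    minor-rowSplit : ∀ (M : V → V → C) b ρ₁ ρ₂ vs cs → b ∉ vs → (∀ c → M b c ≈ ρ₁ c + ρ₂ c) →
      minor M (b ∷ vs) cs ≈ minor (setRow b ρ₁ M) (b ∷ vs) cs + minor (setRow b ρ₂ M) (b ∷ vs) cs
    minor-rowSplit M b ρ₁ ρ₂ vs cs b∉vs split = begin
      laplace (λ c cs′ → M b c * minor M vs cs′) cs
        ≈⟨ laplace-cong cs (λ c cs′ → trans (*-congʳ (split c)) (distribʳ _ _ _)) ⟩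
      laplace (λ c cs′ → ρ₁ c * minor M vs cs′ + ρ₂ c * minor M vs cs′) cs
        ≈⟨ laplace-+ _ _ cs ⟩
      laplace (λ c cs′ → ρ₁ c * minor M vs cs′) cs + laplace (λ c cs′ → ρ₂ c * minor M vs cs′) cs
        ≈⟨ +-cong (minor-setRow b ρ₁ M vs cs b∉vs) (minor-setRow b ρ₂ M vs cs b∉vs) ⟨
      minor (setRow b ρ₁ M) (b ∷ vs) cs + minor (setRow b ρ₂ M) (b ∷ vs) cs ∎

    -- Splitting the row of b into its part on ys and the rest decouples xs from ys.
    minor-borderSplit : ∀ (M : V → V → C) b xs ys → b ∉ xs → b ∉ ys → (∀ {u} → u ∈ xs → u ∉ ys) →
      (∀ u y → u ∈ xs → y ∈ ys → M u y ≈ 0#) → (∀ y u → y ∈ ys → u ∈ xs → M y u ≈ 0#) →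
      minor M (b ∷ xs ++ ys) (b ∷ xs ++ ys) ≈
      minor M (b ∷ xs) (b ∷ xs) * minor M ys ys + minor M xs xs * border M b ys
    minor-borderSplit M b xs ys b∉xs b∉ys xs∩ys=∅ Mxy≈0 Myx≈0 = begin
      minor M (b ∷ xs ++ ys) (b ∷ xs ++ ys)
        ≈⟨ minor-rowSplit M b outer inner (xs ++ ys) (b ∷ xs ++ ys) b∉xs++ys split ⟩
      minor Mₒ (b ∷ xs ++ ys) (b ∷ xs ++ ys) + minor Mᵢ (b ∷ xs ++ ys) (b ∷ xs ++ ys)
        ≈⟨ +-cong outerPart innerPart ⟩
      minor M (b ∷ xs) (b ∷ xs) * minor M ys ys + minor M xs xs * border M b ys ∎
      where
      outer inner : V → C
      outer c = if does (c ∈? ys) then 0# else M b c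
      inner c = if does (c ∈? ys) then M b c else 0#
      Mₒ Mᵢ : V → V → C
      Mₒ = setRow b outer M
      Mᵢ = setRow b inner M

      split : ∀ c → M b c ≈ outer c + inner c
      split c with does (c ∈? ys)
      ... | true  = sym (+-identityˡ _)
      ... | false = sym (+-identityʳ _)

      outer-∈ : ∀ {c} → c ∈ ys → outer c ≡ 0#
      outer-∈ {c} c∈ys rewrite dec-true (c ∈? ys) c∈ys = ≡.refl
      outer-∉ : ∀ {c} → c ∉ ys → outer c ≡ M b c
      outer-∉ {c} c∉ys rewrite dec-false (c ∈? ys) c∉ys = ≡.refl
      inner-∈ : ∀ {c} → c ∈ ys → inner c ≡ M b c
      inner-∈ {c} c∈ys rewrite dec-true (c ∈? ys) c∈ys = ≡.refl
      inner-∉ : ∀ {c} → c ∉ ys → inner c ≡ 0#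
      inner-∉ {c} c∉ys rewrite dec-false (c ∈? ys) c∉ys = ≡.refl

      b∉xs++ys : b ∉ xs ++ ys
      b∉xs++ys b∈ = [ b∉xs , b∉ys ]′ (∈.∈-++⁻ xs b∈)
      ≢b : ∀ {u vs} → b ∉ vs → u ∈ vs → u ≢ b
      ≢b b∉vs u∈vs ≡.refl = b∉vs u∈vs

      outerPart : minor Mₒ ((b ∷ xs) ++ ys) ((b ∷ xs) ++ ys) ≈ minor M (b ∷ xs) (b ∷ xs) * minor M ys ys
      outerPart = begin
        minor Mₒ ((b ∷ xs) ++ ys) ((b ∷ xs) ++ ys)   ≈⟨ minor-++-triangular Mₒ (b ∷ xs) (b ∷ xs) ys ≡.refl Mₒ≈0 ⟩
        minor Mₒ (b ∷ xs) (b ∷ xs) * minor Mₒ ys ys ≈⟨ *-cong (minor-cong (b ∷ xs) (b ∷ xs) Mₒ≈M)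
                                                              (minor-setRow-away outer M ys ys b∉ys) ⟩
        minor M (b ∷ xs) (b ∷ xs) * minor M ys ys   ∎
        where
        Mₒ≈0 : ∀ u y → u ∈ b ∷ xs → y ∈ ys → Mₒ u y ≈ 0#
        Mₒ≈0 u y (here ≡.refl) y∈ = reflexive (≡.trans (setRow-at b outer M y) (outer-∈ y∈))
        Mₒ≈0 u y (there u∈)    y∈ = trans (reflexive (setRow-away outer M y (≢b b∉xs u∈))) (Mxy≈0 u y u∈ y∈)
        Mₒ≈M : ∀ u v → u ∈ b ∷ xs → v ∈ b ∷ xs → Mₒ u v ≈ M u v
        Mₒ≈M u v (here ≡.refl) (here ≡.refl) = reflexive (≡.trans (setRow-at b outer M b) (outer-∉ b∉ys))
        Mₒ≈M u v (here ≡.refl) (there v∈)    = reflexive (≡.trans (setRow-at b outer M v) (outer-∉ (xs∩ys=∅ v∈)))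
        Mₒ≈M u v (there u∈)    _             = reflexive (setRow-away outer M v (≢b b∉xs u∈))

      innerPart : minor Mᵢ (b ∷ xs ++ ys) (b ∷ xs ++ ys) ≈ minor M xs xs * border M b ys
      innerPart = begin
        minor Mᵢ (b ∷ xs ++ ys) (b ∷ xs ++ ys)
          ≈⟨ minor-↭ Mᵢ (↭.prep b (↭ₚ.++-comm xs ys)) ⟩
        minor Mᵢ ((b ∷ ys) ++ xs) ((b ∷ ys) ++ xs)
          ≈⟨ minor-++-triangular Mᵢ (b ∷ ys) (b ∷ ys) xs ≡.refl Mᵢ≈0 ⟩
        minor Mᵢ (b ∷ ys) (b ∷ ys) * minor Mᵢ xs xs
          ≈⟨ *-comm _ _ ⟩
        minor Mᵢ xs xs * (Mᵢ b b * minor Mᵢ ys ys + border Mᵢ b ys)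
          ≈⟨ *-cong (minor-setRow-away inner M xs xs b∉xs)
                    (trans (+-congʳ (trans (*-congʳ Mᵢbb≈0) (zeroˡ _))) (+-identityˡ _)) ⟩
        minor M xs xs * border Mᵢ b ys
          ≈⟨ *-congˡ (border-cong b ys (λ v v∈ → reflexive (≡.trans (setRow-at b inner M v) (inner-∈ v∈)))
                                        (λ u v u∈ _ → reflexive (setRow-away inner M v (≢b b∉ys u∈)))) ⟩
        minor M xs xs * border M b ys ∎
        where
        Mᵢbb≈0 : Mᵢ b b ≈ 0#
        Mᵢbb≈0 = reflexive (≡.trans (setRow-at b inner M b) (inner-∉ b∉ys))
        Mᵢ≈0 : ∀ u x → u ∈ b ∷ ys → x ∈ xs → Mᵢ u x ≈ 0#
        Mᵢ≈0 u x (here ≡.refl) x∈ = reflexive (≡.trans (setRow-at b inner M x) (inner-∉ (xs∩ys=∅ x∈)))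
        Mᵢ≈0 u x (there u∈)    x∈ = trans (reflexive (setRow-away inner M x (≢b b∉ys u∈))) (Myx≈0 u x u∈ x∈)

  sumFin-cong : ∀ n (f g : Fin n → C) → (∀ i → f i ≈ g i) → sumFin R n f ≈ sumFin R n g
  sumFin-cong zero    f g f≈g = refl
  sumFin-cong (suc n) f g f≈g = +-cong (f≈g zero) (sumFin-cong n (f ∘ suc) (g ∘ suc) (f≈g ∘ suc))

  sumFin-neg : ∀ n (f : Fin n → C) → sumFin R n (λ i → - f i) ≈ - sumFin R n f
  sumFin-neg zero    f = sym -0#≈0#
  sumFin-neg (suc n) f = trans (+-congˡ (sumFin-neg n (f ∘ suc))) (-‿+-comm _ _)

  det-cong : ∀ n {M M′ : Fin n → Fin n → C} → (∀ i j → M i j ≈ M′ i j) → det R n M ≈ det R n M′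
  det-cong zero    M≈M′ = refl
  det-cong (suc n) {M} {M′} M≈M′ = sumFin-cong (suc n) _ _ λ j →
    *-congˡ {sgn R j} (*-cong (M≈M′ zero j) (det-cong n λ a b → M≈M′ (suc a) (punchIn j b)))

  module _ {V : Set} where

    sumFin-sgn≈laplace : ∀ n (κ : Fin (suc n) → V) (h : V → List V → C) →
      sumFin R (suc n) (λ j → sgn R j * h (κ j) (tabulate (κ ∘ punchIn j))) ≈ laplace h (tabulate κ)
    sumFin-sgn≈laplace zero    κ h = +-cong (*-identityˡ _) (sym -0#≈0#)
    sumFin-sgn≈laplace (suc n) κ h = +-cong (*-identityˡ _) (begin
      sumFin R (suc n) (λ i → - sgn R i * h′ i)
        ≈⟨ sumFin-cong (suc n) _ (λ i → - (sgn R i * h′ i)) (λ i → sym (-‿distribˡ-* _ _)) ⟩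
      sumFin R (suc n) (λ i → - (sgn R i * h′ i))
        ≈⟨ sumFin-neg (suc n) (λ i → sgn R i * h′ i) ⟩
      - sumFin R (suc n) (λ i → sgn R i * h′ i)
        ≈⟨ -‿cong (sumFin-sgn≈laplace n (κ ∘ suc) (λ d ds → h d (κ zero ∷ ds))) ⟩
      - laplace (λ d ds → h d (κ zero ∷ ds)) (tabulate (κ ∘ suc)) ∎)
      where
      h′ : Fin (suc n) → C
      h′ i = h (κ (suc i)) (κ zero ∷ tabulate (κ ∘ suc ∘ punchIn i))

    det≈minor : ∀ n (ρ κ : Fin n → V) (M : V → V → C) →
      det R n (λ i j → M (ρ i) (κ j)) ≈ minor M (tabulate ρ) (tabulate κ)
    det≈minor zero    ρ κ M = refl
    det≈minor (suc n) ρ κ M = begin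
      sumFin R (suc n) (λ j → sgn R j * (M (ρ zero) (κ j) * det R n (λ a b → M (ρ (suc a)) (κ (punchIn j b)))))
        ≈⟨ sumFin-cong (suc n) _ (λ j → sgn R j * (M (ρ zero) (κ j) * minor M (tabulate (ρ ∘ suc)) (tabulate (κ ∘ punchIn j))))
             (λ j → *-congˡ (*-congˡ (det≈minor n (ρ ∘ suc) (κ ∘ punchIn j) M))) ⟩
      sumFin R (suc n) (λ j → sgn R j * (M (ρ zero) (κ j) * minor M (tabulate (ρ ∘ suc)) (tabulate (κ ∘ punchIn j))))
        ≈⟨ sumFin-sgn≈laplace n κ (λ c cs′ → M (ρ zero) c * minor M (tabulate (ρ ∘ suc)) cs′) ⟩
      minor M (tabulate ρ) (tabulate κ) ∎

module SubsetSums {c ℓ : Level} (R : CommutativeRing c ℓ) where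

  open CommutativeRing R renaming (Carrier to C) hiding (zero)
  open import Relation.Binary.Reasoning.Setoid setoid

  open RingLemmas R using (x*[y*z]≈y*[x*z])

  module _ {A : Set} where

    sumList-++ : ∀ (f : A → C) xs ys → sumList R (map f (xs ++ ys)) ≈ sumList R (map f xs) + sumList R (map f ys)
    sumList-++ f []       ys = sym (+-identityˡ _)
    sumList-++ f (x ∷ xs) ys = trans (+-congˡ (sumList-++ f xs ys)) (sym (+-assoc _ _ _))

    sumList-*ˡ : ∀ k (f : A → C) xs → sumList R (map (λ x → k * f x) xs) ≈ k * sumList R (map f xs)
    sumList-*ˡ k f []       = sym (zeroʳ k)
    sumList-*ˡ k f (x ∷ xs) = trans (+-congˡ (sumList-*ˡ k f xs)) (sym (distribˡ k _ _))

    sumList-cong : ∀ (f g : A → C) xs → (∀ x → x ∈ xs → f x ≈ g x) → sumList R (map f xs) ≈ sumList R (map g xs)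
    sumList-cong f g []       f≈g = refl
    sumList-cong f g (x ∷ xs) f≈g = +-cong (f≈g x (here ≡.refl)) (sumList-cong f g xs λ y y∈ → f≈g y (there y∈))

    sumList-+ : ∀ (f g : A → C) xs → sumList R (map (λ x → f x + g x) xs) ≈ sumList R (map f xs) + sumList R (map g xs)
    sumList-+ f g []       = sym (+-identityʳ 0#)
    sumList-+ f g (x ∷ xs) = begin
      (f x + g x) + sumList R (map (λ x → f x + g x) xs) ≈⟨ +-congˡ (sumList-+ f g xs) ⟩
      (f x + g x) + (F + G)                              ≈⟨ +-assoc _ _ _ ⟩
      f x + (g x + (F + G))                              ≈⟨ +-congˡ (+-assoc _ _ _) ⟨
      f x + ((g x + F) + G)                              ≈⟨ +-congˡ (+-congʳ (+-comm _ _)) ⟩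
      f x + ((F + g x) + G)                              ≈⟨ +-congˡ (+-assoc _ _ _) ⟩
      f x + (F + (g x + G))                              ≈⟨ +-assoc _ _ _ ⟨
      (f x + F) + (g x + G)                              ∎
      where
      F = sumList R (map f xs)
      G = sumList R (map g xs)

    sumList-0# : ∀ (f : A → C) xs → (∀ x → x ∈ xs → f x ≈ 0#) → sumList R (map f xs) ≈ 0#
    sumList-0# f []       f≈0 = refl
    sumList-0# f (x ∷ xs) f≈0 =
      trans (+-cong (f≈0 x (here ≡.refl)) (sumList-0# f xs λ y y∈ → f≈0 y (there y∈))) (+-identityʳ 0#)

    sumList-map : ∀ {B : Set} (f : A → C) (g : B → A) xs → sumList R (map f (map g xs)) ≡ sumList R (map (λ x → f (g x)) xs)
    sumList-map f g []       = ≡.refl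
    sumList-map f g (x ∷ xs) = ≡.cong (f (g x) +_) (sumList-map f g xs)

  sumList-indicator : ∀ n (a : C) ks → Unique ks → n ∈ ks →
    sumList R (map (λ k → if does (n ℕ.≟ k) then a else 0#) ks) ≈ a
  sumList-indicator n a (k ∷ ks) (n∉ks ∷ _) (here ≡.refl) rewrite dec-true (n ℕ.≟ n) ≡.refl =
    trans (+-congˡ (sumList-0# _ ks λ k k∈ →
             reflexive (≡.cong (if_then a else 0#) (dec-false (n ℕ.≟ k) (All.lookup n∉ks k∈)))))
          (+-identityʳ a)
  sumList-indicator n a (k ∷ ks) (k∉ks ∷ ks!) (there n∈ks)
    rewrite dec-false (n ℕ.≟ k) (λ { ≡.refl → All.lookup k∉ks n∈ks ≡.refl }) =
    trans (+-identityˡ _) (sumList-indicator n a ks ks! n∈ks)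

  module _ {X : Set} where

    sumList-byLength : ∀ n (f : List X → C) Ss → All (λ S → length S ≤ n) Ss →
      sumList R (map f Ss) ≈
      sumList R (map (λ k → sumList R (map f (filterᵇ (λ S → does (length S ℕ.≟ k)) Ss))) (upTo (suc n)))
    sumList-byLength n f []       _           = sym (sumList-0# _ (upTo (suc n)) λ _ _ → refl)
    sumList-byLength n f (S ∷ Ss) (|S|≤n ∷ Ss≤n) = sym (begin
      sumList R (map (λ k → sumList R (map f (byLength k (S ∷ Ss)))) ks)
        ≈⟨ sumList-cong _ _ ks (λ k _ → step k) ⟩
      sumList R (map (λ k → (if does (length S ℕ.≟ k) then f S else 0#) + sumList R (map f (byLength k Ss))) ks)
        ≈⟨ sumList-+ _ _ ks ⟩
      sumList R (map (λ k → if does (length S ℕ.≟ k) then f S else 0#) ks) +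
      sumList R (map (λ k → sumList R (map f (byLength k Ss))) ks)
        ≈⟨ +-cong (sumList-indicator (length S) (f S) ks (Unique.upTo⁺ (suc n)) (∈.∈-upTo⁺ (s≤s |S|≤n)))
                  (sym (sumList-byLength n f Ss Ss≤n)) ⟩
      f S + sumList R (map f Ss) ∎)
      where
      ks = upTo (suc n)
      byLength : ℕ → List (List X) → List (List X)
      byLength k = filterᵇ (λ S → does (length S ℕ.≟ k))
      step : ∀ k → sumList R (map f (byLength k (S ∷ Ss))) ≈
                   (if does (length S ℕ.≟ k) then f S else 0#) + sumList R (map f (byLength k Ss))
      step k with does (length S ℕ.≟ k)
      ... | true  = refl
      ... | false = sym (+-identityˡ _)

    sublists-length : ∀ (bs : List X) → All (λ S → length S ≤ length bs) (sublists bs)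
    sublists-length []       = z≤n ∷ []
    sublists-length (b ∷ bs) =
      All.++⁺ (All.map ℕₚ.m≤n⇒m≤1+n (sublists-length bs)) (All.map⁺ (All.map s≤s (sublists-length bs)))

    subsetTerm : C → C → ℕ → (List X → C) → List X → C
    subsetTerm p a n f S = pow R p (n ∸ length S) * (pow R a (length S) * f S)

    subsetSum : C → C → List X → (List X → C) → C
    subsetSum p a bs f = sumList R (map (subsetTerm p a (length bs) f) (sublists bs))

    subsetSum-cong : ∀ {p p′ a a′} bs (f g : List X → C) → p ≈ p′ → a ≈ a′ → (∀ S → f S ≈ g S) →
      subsetSum p a bs f ≈ subsetSum p′ a′ bs g
    subsetSum-cong {p} {p′} {a} {a′} bs f g p≈p′ a≈a′ f≈g =
      sumList-cong _ _ (sublists bs) λ S _ →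
        *-cong (pow-cong p≈p′ (length bs ∸ length S)) (*-cong (pow-cong a≈a′ (length S)) (f≈g S))
      where
      pow-cong : ∀ {x y} → x ≈ y → ∀ n → pow R x n ≈ pow R y n
      pow-cong x≈y zero    = refl
      pow-cong x≈y (suc n) = *-cong x≈y (pow-cong x≈y n)

    subsetSum-[] : ∀ p a (f : List X → C) → subsetSum p a [] f ≈ f []
    subsetSum-[] p a f = trans (+-identityʳ _) (trans (*-identityˡ _) (*-identityˡ _))

    subsetSum-∷ : ∀ p a b bs (f : List X → C) →
      subsetSum p a (b ∷ bs) f ≈ p * subsetSum p a bs f + a * subsetSum p a bs (λ S → f (b ∷ S))
    subsetSum-∷ p a b bs f = begin
      sumList R (map (subsetTerm p a (suc n) f) (sublists bs ++ map (b ∷_) (sublists bs)))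
        ≈⟨ sumList-++ _ (sublists bs) _ ⟩
      sumList R (map (subsetTerm p a (suc n) f) (sublists bs)) +
      sumList R (map (subsetTerm p a (suc n) f) (map (b ∷_) (sublists bs)))
        ≈⟨ +-cong (sumList-cong _ _ (sublists bs) without-b)
                  (trans (reflexive (sumList-map _ (b ∷_) (sublists bs))) (sumList-cong _ _ (sublists bs) λ S _ → with-b S)) ⟩
      sumList R (map (λ S → p * subsetTerm p a n f S) (sublists bs)) +
      sumList R (map (λ S → a * subsetTerm p a n (λ T → f (b ∷ T)) S) (sublists bs))
        ≈⟨ +-cong (sumList-*ˡ p _ (sublists bs)) (sumList-*ˡ a _ (sublists bs)) ⟩
      p * subsetSum p a bs f + a * subsetSum p a bs (λ S → f (b ∷ S)) ∎
      where
      n = length bs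
      without-b : ∀ S → S ∈ sublists bs → subsetTerm p a (suc n) f S ≈ p * subsetTerm p a n f S
      without-b S S∈ = trans (*-congʳ (reflexive (≡.cong (pow R p) (ℕₚ.+-∸-assoc 1 (All.lookup (sublists-length bs) S∈)))))
                             (*-assoc _ _ _)
      with-b : ∀ S → subsetTerm p a (suc n) f (b ∷ S) ≈ a * subsetTerm p a n (λ T → f (b ∷ T)) S
      with-b S = begin
        pow R p (n ∸ length S) * ((a * pow R a (length S)) * f (b ∷ S)) ≈⟨ *-congˡ (*-assoc _ _ _) ⟩
        pow R p (n ∸ length S) * (a * (pow R a (length S) * f (b ∷ S))) ≈⟨ x*[y*z]≈y*[x*z] _ _ _ ⟩
        a * subsetTerm p a n (λ T → f (b ∷ T)) S                       ∎

    subsetSum-byCardinality : ∀ p a bs (f : List X → C) →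
      subsetSum p a bs f ≈
      sumList R (map (λ k → pow R p (length bs ∸ k) *
                              (pow R a k * sumList R (map f (filterᵇ (λ S → does (length S ℕ.≟ k)) (sublists bs)))))
                     (upTo (suc (length bs))))
    subsetSum-byCardinality p a bs f =
      trans (sumList-byLength n (subsetTerm p a n f) (sublists bs) (sublists-length bs))
            (sumList-cong _ _ (upTo (suc n)) λ k _ → cardinality-k k)
      where
      n = length bs
      ofSize : ℕ → List (List X)
      ofSize k = filterᵇ (λ S → does (length S ℕ.≟ k)) (sublists bs)
      ofSize-length : ∀ {k S} → S ∈ ofSize k → length S ≡ k
      ofSize-length {k} {S} S∈ =
        ℕₚ.≡ᵇ⇒≡ (length S) k (proj₂ (∈.∈-filter⁻ (λ S → T? (does (length S ℕ.≟ k))) {xs = sublists bs} S∈))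
      cardinality-k : ∀ k → sumList R (map (subsetTerm p a n f) (ofSize k)) ≈
                            pow R p (n ∸ k) * (pow R a k * sumList R (map f (ofSize k)))
      cardinality-k k = begin
        sumList R (map (subsetTerm p a n f) (ofSize k))
          ≈⟨ sumList-cong _ _ (ofSize k) (λ S S∈ →
               reflexive (≡.cong (λ m → pow R p (n ∸ m) * (pow R a m * f S)) (ofSize-length S∈))) ⟩
        sumList R (map (λ S → pow R p (n ∸ k) * (pow R a k * f S)) (ofSize k))
          ≈⟨ sumList-*ˡ _ _ (ofSize k) ⟩
        pow R p (n ∸ k) * sumList R (map (λ S → pow R a k * f S) (ofSize k))
          ≈⟨ *-congˡ (sumList-*ˡ _ _ (ofSize k)) ⟩
        pow R p (n ∸ k) * (pow R a k * sumList R (map f (ofSize k))) ∎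

module Copies {X Y : Set} (G′ : List Y) where

  copy : X → List (X ⊎ (X × Y))
  copy b = map (λ v → inj₂ (b , v)) G′

  copies : List X → List (X ⊎ (X × Y))
  copies = concatMap copy

  ∈-copies⁻ : ∀ bs {u} → u ∈ copies bs → ∃₂ λ b v → b ∈ bs × v ∈ G′ × u ≡ inj₂ (b , v)
  ∈-copies⁻ (b ∷ bs) u∈ with ∈.∈-++⁻ (copy b) u∈
  ... | inj₁ u∈copy with ∈.∈-map⁻ (λ v → inj₂ (b , v)) u∈copy
  ...   | v , v∈ , u≡ = b , v , here ≡.refl , v∈ , u≡
  ∈-copies⁻ (b ∷ bs) u∈ | inj₂ u∈copies with ∈-copies⁻ bs u∈copies
  ...   | b′ , v , b′∈ , v∈ , u≡ = b′ , v , there b′∈ , v∈ , u≡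

  copies-unique : Unique G′ → ∀ bs → Unique bs → Unique (copies bs)
  copies-unique G′! []       _              = []
  copies-unique G′! (b ∷ bs) (b∉bs ∷ bs!) =
    Unique.++⁺ (Unique.map⁺ (λ { ≡.refl → ≡.refl }) G′!) (copies-unique G′! bs bs!) copy∩copies=∅
    where
    copy∩copies=∅ : ∀ {u} → u ∈ copy b × u ∈ copies bs → ⊥
    copy∩copies=∅ (u∈copy , u∈copies) with ∈.∈-map⁻ (λ v → inj₂ (b , v)) u∈copy | ∈-copies⁻ bs u∈copies
    ... | _ , _ , ≡.refl | b′ , _ , b′∈ , _ , ≡.refl = All.lookup b∉bs b′∈ ≡.refl

module CoalescedMinors {c ℓ : Level} (R : CommutativeRing c ℓ)
  {X Y : Set} (_≟X_ : DecidableEquality X) (_≟Y_ : DecidableEquality Y)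
  (A : X → X → CommutativeRing.Carrier R) (Gm : Y → Y → CommutativeRing.Carrier R)
  (r : Y) (G′ : List Y) (r∉G′ : r ∉ G′) (c₀ : CommutativeRing.Carrier R) where

  open CommutativeRing R renaming (Carrier to C) hiding (zero)
  open import Relation.Binary.Reasoning.Setoid setoid
  open Minors R
  open SubsetSums R
  open Copies {X} G′

  open DecidableLists _≟X_ using () renaming (_∈ᵇ_ to _∈ˣ_)

  _≟V_ : DecidableEquality (X ⊎ (X × Y))
  _≟V_ = Sum.≡-dec _≟X_ (Product.≡-dec _≟X_ _≟Y_)

  if-≟-refl : ∀ b {a d : C} → (if does (b ≟X b) then a else d) ≡ a
  if-≟-refl b rewrite dec-true (b ≟X b) ≡.refl = ≡.refl

  if-≟-≢ : ∀ {h b} {a d : C} → h ≢ b → (if does (h ≟X b) then a else d) ≡ d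
  if-≟-≢ {h} {b} h≢b rewrite dec-false (h ≟X b) h≢b = ≡.refl

  _∖_ : List X → List X → List X
  hs ∖ S = filterᵇ (λ v → not (v ∈ˣ S)) hs

  -- In the application p₀ = p_{G,r} and p₁ = p_G - x p_{G,r}.
  p₀ p₁ : C
  p₀ = minor Gm G′ G′
  p₁ = border Gm r G′ + c₀ * p₀

  record IsCoalesced (hs bs : List X) (E : X ⊎ (X × Y) → X ⊎ (X × Y) → C) : Set (c ⊔ ℓ) where
    field
      hs-unique     : Unique hs
      bs-unique     : Unique bs
      bs⊆hs         : ∀ {b} → b ∈ bs → b ∈ hs
      diagonal      : ∀ h → h ∈ hs → E (inj₁ h) (inj₁ h) ≈ A h h + (if h ∈ˣ bs then c₀ else 0#)
      offDiagonal   : ∀ h h′ → h ∈ hs → h′ ∈ hs → h ≢ h′ → E (inj₁ h) (inj₁ h′) ≈ A h h′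
      root→copy     : ∀ h b v → b ∈ bs → v ∈ G′ → E (inj₁ h) (inj₂ (b , v)) ≈ (if does (h ≟X b) then Gm r v else 0#)
      copy→root     : ∀ h b v → b ∈ bs → v ∈ G′ → E (inj₂ (b , v)) (inj₁ h) ≈ (if does (h ≟X b) then Gm v r else 0#)
      copy→copy     : ∀ b b′ v v′ → b ∈ bs → b′ ∈ bs → v ∈ G′ → v′ ∈ G′ →
                      E (inj₂ (b , v)) (inj₂ (b′ , v′)) ≈ (if does (b ≟X b′) then Gm v v′ else 0#)

  module PeelAttachment {b : X} {bs hs : List X} {E : X ⊎ (X × Y) → X ⊎ (X × Y) → C}
                        (coal : IsCoalesced hs (b ∷ bs) E) where
    open IsCoalesced coal

    hs⁻ : List X
    hs⁻ = remove _≟X_ b hs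

    xs ys : List (X ⊎ (X × Y))
    xs = map inj₁ hs⁻ ++ copies bs
    ys = copy b

    b∈hs : b ∈ hs
    b∈hs = bs⊆hs (here ≡.refl)

    b∉bs : b ∉ bs
    b∉bs = Unique.Unique[x∷xs]⇒x∉xs bs-unique

    bs-unique′ : Unique bs
    bs-unique′ with bs-unique
    ... | _ ∷ bs! = bs!

    ≢b : ∀ {b′} → b′ ∈ bs → b′ ≢ b
    ≢b b′∈ ≡.refl = b∉bs b′∈

    ↭-split : map inj₁ hs ++ copies (b ∷ bs) ↭ inj₁ b ∷ xs ++ ys
    ↭-split = ↭.trans (↭ₚ.++⁺ʳ (ys ++ copies bs) (↭ₚ.map⁺ inj₁ (↭-remove _≟X_ hs hs-unique b∈hs)))
              (↭.trans (↭.prep (inj₁ b) (↭ₚ.++⁺ˡ (map inj₁ hs⁻) (↭ₚ.++-comm ys (copies bs))))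
                       (↭-reflexive (≡.cong (inj₁ b ∷_) (≡.sym (List.++-assoc (map inj₁ hs⁻) (copies bs) ys)))))

    data InXs : X ⊎ (X × Y) → Set where
      root : ∀ {h} → h ∈ hs⁻ → InXs (inj₁ h)
      copyVertex : ∀ {b′ v} → b′ ∈ bs → v ∈ G′ → InXs (inj₂ (b′ , v))

    inXs : ∀ {u} → u ∈ xs → InXs u
    inXs u∈ with ∈.∈-++⁻ (map inj₁ hs⁻) u∈
    ... | inj₁ u∈roots with ∈.∈-map⁻ inj₁ u∈roots
    ...   | h , h∈ , ≡.refl = root h∈
    inXs u∈ | inj₂ u∈copies with ∈-copies⁻ bs u∈copies
    ...   | b′ , v , b′∈ , v∈ , ≡.refl = copyVertex b′∈ v∈

    inYs : ∀ {u} → u ∈ ys → ∃ λ v → v ∈ G′ × u ≡ inj₂ (b , v)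
    inYs u∈ with ∈.∈-map⁻ (λ v → inj₂ (b , v)) u∈
    ... | v , v∈ , u≡ = v , v∈ , u≡

    b∉xs : inj₁ b ∉ xs
    b∉xs b∈ with inXs b∈
    ... | root b∈hs⁻ = ∉-remove _≟X_ b hs b∈hs⁻

    b∉ys : inj₁ b ∉ ys
    b∉ys b∈ with inYs b∈
    ... | _ , _ , ()

    xs∩ys=∅ : ∀ {u} → u ∈ xs → u ∉ ys
    xs∩ys=∅ u∈xs u∈ys with inXs u∈xs | inYs u∈ys
    ... | copyVertex b′∈ _ | _ , _ , ≡.refl = b∉bs b′∈

    E-xs-ys≈0 : ∀ u y → u ∈ xs → y ∈ ys → E u y ≈ 0#
    E-xs-ys≈0 u y u∈ y∈ with inXs u∈ | inYs y∈
    ... | root {h} h∈ | v , v∈ , ≡.refl =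
      trans (root→copy h b v (here ≡.refl) v∈) (reflexive (if-≟-≢ (remove-≢ _≟X_ {xs = hs} h∈)))
    ... | copyVertex {b′} {v′} b′∈ v′∈ | v , v∈ , ≡.refl =
      trans (copy→copy b′ b v′ v (there b′∈) (here ≡.refl) v′∈ v∈) (reflexive (if-≟-≢ (≢b b′∈)))

    E-ys-xs≈0 : ∀ y u → y ∈ ys → u ∈ xs → E y u ≈ 0#
    E-ys-xs≈0 y u y∈ u∈ with inXs u∈ | inYs y∈
    ... | root {h} h∈ | v , v∈ , ≡.refl =
      trans (copy→root h b v (here ≡.refl) v∈) (reflexive (if-≟-≢ (remove-≢ _≟X_ {xs = hs} h∈)))
    ... | copyVertex {b′} {v′} b′∈ v′∈ | v , v∈ , ≡.refl =
      trans (copy→copy b b′ v v′ (here ≡.refl) (there b′∈) v∈ v′∈) (reflexive (if-≟-≢ (λ b≡b′ → ≢b b′∈ (≡.sym b≡b′))))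

    minor-copy : minor E ys ys ≈ p₀
    minor-copy = trans (minor-map (λ v → inj₂ (b , v)) E G′ G′) (minor-cong G′ G′ λ u v u∈ v∈ →
      trans (copy→copy b b u v (here ≡.refl) (here ≡.refl) u∈ v∈) (reflexive (if-≟-refl b)))

    border-copy : border E (inj₁ b) ys ≈ border Gm r G′
    border-copy = begin
      border E (inj₁ b) ys                ≈⟨ reflexive (≡.cong₂ (border E) (≡.sym g-r) (≡.sym (map-g G′ λ v∈ → v∈))) ⟩
      border E (g r) (map g G′)           ≈⟨ border-map g E r G′ ⟩
      border (λ u v → E (g u) (g v)) r G′ ≈⟨ border-cong r G′ E∘g≈Gmʳ E∘g≈Gm ⟩
      border Gm r G′                      ∎
      where
      g : Y → X ⊎ (X × Y)
      g v = if does (v ≟Y r) then inj₁ b else inj₂ (b , v)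
      g-r : g r ≡ inj₁ b
      g-r rewrite dec-true (r ≟Y r) ≡.refl = ≡.refl
      g-G′ : ∀ {v} → v ∈ G′ → g v ≡ inj₂ (b , v)
      g-G′ {v} v∈ rewrite dec-false (v ≟Y r) (λ { ≡.refl → r∉G′ v∈ }) = ≡.refl
      map-g : ∀ vs → (∀ {v} → v ∈ vs → v ∈ G′) → map g vs ≡ map (λ v → inj₂ (b , v)) vs
      map-g []       _    = ≡.refl
      map-g (v ∷ vs) vs⊆ = ≡.cong₂ _∷_ (g-G′ (vs⊆ (here ≡.refl))) (map-g vs (λ v∈ → vs⊆ (there v∈)))
      E∘g≈Gmʳ : ∀ d → d ∈ G′ → E (g r) (g d) ≈ Gm r d
      E∘g≈Gmʳ d d∈ rewrite g-r | g-G′ d∈ =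
        trans (root→copy b b d (here ≡.refl) d∈) (reflexive (if-≟-refl b))
      E∘g≈Gm : ∀ u v → u ∈ G′ → v ∈ r ∷ G′ → E (g u) (g v) ≈ Gm u v
      E∘g≈Gm u v u∈ (here ≡.refl) rewrite g-r | g-G′ u∈ =
        trans (copy→root b b u (here ≡.refl) u∈) (reflexive (if-≟-refl b))
      E∘g≈Gm u v u∈ (there v∈) rewrite g-G′ u∈ | g-G′ v∈ =
        trans (copy→copy b b u v (here ≡.refl) (here ≡.refl) u∈ v∈) (reflexive (if-≟-refl b))

    hs⁻-unique : Unique hs⁻
    hs⁻-unique = Unique.filter⁺ (λ v → T? (not (does (v ≟X b)))) hs-unique

    bs⊆hs⁻ : ∀ {b′} → b′ ∈ bs → b′ ∈ hs⁻
    bs⊆hs⁻ b′∈ = ∈-remove _≟X_ (bs⊆hs (there b′∈)) (≢b b′∈)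

    coalesced-remove : IsCoalesced hs⁻ bs E
    coalesced-remove = record
      { hs-unique   = hs⁻-unique
      ; bs-unique   = bs-unique′
      ; bs⊆hs       = bs⊆hs⁻
      ; diagonal    = λ h h∈ → trans (diagonal h (remove-⊆ _≟X_ h∈))
          (reflexive (≡.cong (λ t → A h h + (if t ∨ h ∈ˣ bs then c₀ else 0#))
                             (dec-false (h ≟X b) (remove-≢ _≟X_ {xs = hs} h∈))))
      ; offDiagonal = λ h h′ h∈ h′∈ → offDiagonal h h′ (remove-⊆ _≟X_ h∈) (remove-⊆ _≟X_ h′∈)
      ; root→copy   = λ h b′ v b′∈ → root→copy h b′ v (there b′∈)
      ; copy→root   = λ h b′ v b′∈ → copy→root h b′ v (there b′∈)
      ; copy→copy   = λ b₁ b₂ v v′ b₁∈ b₂∈ → copy→copy b₁ b₂ v v′ (there b₁∈) (there b₂∈)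
      }

    atB : X ⊎ (X × Y) → Bool
    atB (inj₁ h) = does (h ≟X b)
    atB (inj₂ _) = false

    -- Lowering the diagonal entry at b by c₀ turns b into an ordinary vertex of H.
    E° : X ⊎ (X × Y) → X ⊎ (X × Y) → C
    E° u v = if atB u ∧ atB v then E u v - c₀ else E u v

    E°-row : ∀ {u} v → atB u ≡ false → E° u v ≡ E u v
    E°-row v atB-u rewrite atB-u = ≡.refl

    E°-column : ∀ u {v} → atB v ≡ false → E° u v ≡ E u v
    E°-column u {v} atB-v rewrite atB-v | ∧-zeroʳ (atB u) = ≡.refl

    E°-bb : E° (inj₁ b) (inj₁ b) ≡ E (inj₁ b) (inj₁ b) - c₀
    E°-bb rewrite dec-true (b ≟X b) ≡.refl = ≡.refl

    atB-xs : ∀ {u} → u ∈ xs → atB u ≡ false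
    atB-xs u∈ with inXs u∈
    ... | root h∈       = dec-false (_ ≟X b) (remove-≢ _≟X_ {xs = hs} h∈)
    ... | copyVertex _ _ = ≡.refl

    atB-hs⁻ : ∀ {h} → h ∈ hs⁻ → atB (inj₁ h) ≡ false
    atB-hs⁻ h∈ = dec-false (_ ≟X b) (remove-≢ _≟X_ {xs = hs} h∈)

    minor-shift : minor E (inj₁ b ∷ xs) (inj₁ b ∷ xs) ≈ minor E° (inj₁ b ∷ xs) (inj₁ b ∷ xs) + c₀ * minor E xs xs
    minor-shift = minor-shiftDiagonal E E° (inj₁ b) xs c₀
      (λ u v u∈ → sym (reflexive (E°-row v (atB-xs u∈))))
      (λ v v∈ → sym (reflexive (E°-column (inj₁ b) (atB-xs v∈))))
      (sym (trans (+-congʳ (reflexive E°-bb)) (trans (+-assoc _ _ _) (trans (+-congˡ (-‿inverseˡ c₀)) (+-identityʳ _)))))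

    coalesced-shift : IsCoalesced (b ∷ hs⁻) bs E°
    coalesced-shift = record
      { hs-unique   = All.tabulate (λ h∈ b≡h → ∉-remove _≟X_ b hs (≡.subst (_∈ hs⁻) (≡.sym b≡h) h∈)) ∷ hs⁻-unique
      ; bs-unique   = bs-unique′
      ; bs⊆hs       = λ b′∈ → there (bs⊆hs⁻ b′∈)
      ; diagonal    = diagonal°
      ; offDiagonal = offDiagonal°
      ; root→copy   = λ h b′ v b′∈ v∈ →
          trans (reflexive (E°-column (inj₁ h) ≡.refl)) (root→copy h b′ v (there b′∈) v∈)
      ; copy→root   = λ h b′ v b′∈ v∈ →
          trans (reflexive (E°-row (inj₁ h) ≡.refl)) (copy→root h b′ v (there b′∈) v∈)
      ; copy→copy   = λ b₁ b₂ v v′ b₁∈ b₂∈ v∈ v′∈ → trans (reflexive (E°-row (inj₂ (b₂ , v′)) ≡.refl))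
                        (copy→copy b₁ b₂ v v′ (there b₁∈) (there b₂∈) v∈ v′∈)
      }
      where
      open IsCoalesced coalesced-remove using () renaming (diagonal to diagonal⁻)
      diagonal° : ∀ h → h ∈ b ∷ hs⁻ → E° (inj₁ h) (inj₁ h) ≈ A h h + (if h ∈ˣ bs then c₀ else 0#)
      diagonal° h (here ≡.refl) = begin
        E° (inj₁ b) (inj₁ b)                          ≈⟨ reflexive E°-bb ⟩
        E (inj₁ b) (inj₁ b) - c₀                      ≈⟨ +-congʳ (diagonal b b∈hs) ⟩
        (A b b + (if b ∈ˣ (b ∷ bs) then c₀ else 0#)) - c₀
          ≈⟨ +-congʳ (+-congˡ (reflexive (≡.cong (λ t → if t ∨ b ∈ˣ bs then c₀ else 0#) (dec-true (b ≟X b) ≡.refl)))) ⟩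
        (A b b + c₀) - c₀                             ≈⟨ +-assoc _ _ _ ⟩
        A b b + (c₀ - c₀)                             ≈⟨ +-congˡ (-‿inverseʳ c₀) ⟩
        A b b + 0#                                    ≈⟨ +-congˡ (reflexive (≡.cong (if_then c₀ else 0#) (∈ᵇ-false _≟X_ b∉bs))) ⟨
        A b b + (if b ∈ˣ bs then c₀ else 0#)   ∎
      diagonal° h (there h∈) = trans (reflexive (E°-row (inj₁ h) (atB-hs⁻ h∈))) (diagonal⁻ h h∈)
      offDiagonal° : ∀ h h′ → h ∈ b ∷ hs⁻ → h′ ∈ b ∷ hs⁻ → h ≢ h′ → E° (inj₁ h) (inj₁ h′) ≈ A h h′
      offDiagonal° h h′ (here ≡.refl) (here ≡.refl) h≢h′ = contradiction ≡.refl h≢h′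
      offDiagonal° h h′ (here ≡.refl) (there h′∈)   h≢h′ =
        trans (reflexive (E°-column (inj₁ b) (atB-hs⁻ h′∈))) (offDiagonal h h′ b∈hs (remove-⊆ _≟X_ h′∈) h≢h′)
      offDiagonal° h h′ (there h∈)    h′∈           h≢h′ =
        trans (reflexive (E°-row (inj₁ h′) (atB-hs⁻ h∈))) (offDiagonal h h′ (remove-⊆ _≟X_ h∈) (b∷hs⁻⊆hs h′∈) h≢h′)
        where
        b∷hs⁻⊆hs : ∀ {u} → u ∈ b ∷ hs⁻ → u ∈ hs
        b∷hs⁻⊆hs (here ≡.refl) = b∈hs
        b∷hs⁻⊆hs (there u∈)    = remove-⊆ _≟X_ u∈

    ∖-remove : ∀ S → hs⁻ ∖ S ≡ hs ∖ (b ∷ S)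
    ∖-remove S = ≡.trans (filterᵇ-filterᵇ _ _ hs)
                         (filterᵇ-cong (λ v → ≡.sym (not-∨ (does (v ≟X b)) (v ∈ˣ S))) hs)

  minorWithout : List X → List X → C
  minorWithout hs S = minor A (hs ∖ S) (hs ∖ S)

  [w+c₀w′]p₀+w′ρ≈p₀w+[ρ+c₀p₀]w′ : ∀ w w′ ρ → (w + c₀ * w′) * p₀ + w′ * ρ ≈ p₀ * w + (ρ + c₀ * p₀) * w′
  [w+c₀w′]p₀+w′ρ≈p₀w+[ρ+c₀p₀]w′ w w′ ρ = begin
    (w + c₀ * w′) * p₀ + w′ * ρ         ≈⟨ +-congʳ (distribʳ p₀ w (c₀ * w′)) ⟩
    (w * p₀ + (c₀ * w′) * p₀) + w′ * ρ  ≈⟨ +-assoc _ _ _ ⟩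
    w * p₀ + ((c₀ * w′) * p₀ + w′ * ρ)  ≈⟨ +-cong (*-comm w p₀) (+-comm _ _) ⟩
    p₀ * w + (w′ * ρ + (c₀ * w′) * p₀)  ≈⟨ +-congˡ (+-cong (*-comm w′ ρ) c₀w′p₀≈c₀p₀w′) ⟩
    p₀ * w + (ρ * w′ + (c₀ * p₀) * w′)  ≈⟨ +-congˡ (distribʳ w′ ρ (c₀ * p₀)) ⟨
    p₀ * w + (ρ + c₀ * p₀) * w′         ∎
    where
    c₀w′p₀≈c₀p₀w′ : (c₀ * w′) * p₀ ≈ (c₀ * p₀) * w′
    c₀w′p₀≈c₀p₀w′ = trans (*-assoc c₀ w′ p₀) (trans (*-congˡ (*-comm w′ p₀)) (sym (*-assoc c₀ p₀ w′)))

  minor-coalesced : ∀ bs hs E → IsCoalesced hs bs E →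
    minor E (map inj₁ hs ++ copies bs) (map inj₁ hs ++ copies bs) ≈ subsetSum p₀ p₁ bs (minorWithout hs)
  minor-coalesced [] hs E coal = begin
    minor E (map inj₁ hs ++ []) (map inj₁ hs ++ [])  ≈⟨ minor-≡ E (List.++-identityʳ (map inj₁ hs)) ⟩
    minor E (map inj₁ hs) (map inj₁ hs)              ≈⟨ minor-map inj₁ E hs hs ⟩
    minor (λ u v → E (inj₁ u) (inj₁ v)) hs hs        ≈⟨ minor-cong hs hs E≈A ⟩
    minor A hs hs                                    ≈⟨ minor-≡ A (≡.sym (List.filter-all _ (All.universal (λ _ → tt) hs))) ⟩
    minorWithout hs []                               ≈⟨ subsetSum-[] p₀ p₁ (minorWithout hs) ⟨
    subsetSum p₀ p₁ [] (minorWithout hs)             ∎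
    where
    open IsCoalesced coal
    E≈A : ∀ u v → u ∈ hs → v ∈ hs → E (inj₁ u) (inj₁ v) ≈ A u v
    E≈A u v u∈ v∈ with u ≟X v
    ... | yes ≡.refl = trans (diagonal u u∈) (+-identityʳ _)
    ... | no u≢v     = offDiagonal u v u∈ v∈ u≢v
  minor-coalesced (b ∷ bs) hs E coal = begin
    minor E (map inj₁ hs ++ copies (b ∷ bs)) (map inj₁ hs ++ copies (b ∷ bs))
      ≈⟨ minor-↭ E ↭-split ⟩
    minor E (inj₁ b ∷ xs ++ ys) (inj₁ b ∷ xs ++ ys)
      ≈⟨ minor-borderSplit _≟V_ E (inj₁ b) xs ys b∉xs b∉ys xs∩ys=∅ E-xs-ys≈0 E-ys-xs≈0 ⟩
    minor E (inj₁ b ∷ xs) (inj₁ b ∷ xs) * minor E ys ys + minor E xs xs * border E (inj₁ b) ys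
      ≈⟨ +-cong (*-cong minor-shift minor-copy) (*-congˡ border-copy) ⟩
    (minor E° (inj₁ b ∷ xs) (inj₁ b ∷ xs) + c₀ * minor E xs xs) * p₀ + minor E xs xs * border Gm r G′
      ≈⟨ +-cong (*-congʳ (+-cong shifted (*-congˡ removed))) (*-congʳ removed) ⟩
    (W + c₀ * W′) * p₀ + W′ * border Gm r G′
      ≈⟨ [w+c₀w′]p₀+w′ρ≈p₀w+[ρ+c₀p₀]w′ W W′ (border Gm r G′) ⟩
    p₀ * W + p₁ * W′
      ≈⟨ subsetSum-∷ p₀ p₁ b bs (minorWithout hs) ⟨
    subsetSum p₀ p₁ (b ∷ bs) (minorWithout hs) ∎
    where
    open IsCoalesced coal using (hs-unique)
    open PeelAttachment coal
    W W′ : C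
    W  = subsetSum p₀ p₁ bs (minorWithout hs)
    W′ = subsetSum p₀ p₁ bs (λ S → minorWithout hs (b ∷ S))
    shifted : minor E° (inj₁ b ∷ xs) (inj₁ b ∷ xs) ≈ W
    shifted = trans (minor-coalesced bs (b ∷ hs⁻) E° coalesced-shift) (subsetSum-cong bs _ _ refl refl λ S →
      minor-↭ A (↭ₚ.filter-↭ (λ v → T? (not (v ∈ˣ S))) (↭-sym (↭-remove _≟X_ hs hs-unique b∈hs))))
    removed : minor E xs xs ≈ W′
    removed = trans (minor-coalesced bs hs⁻ E coalesced-remove) (subsetSum-cong bs _ _ refl refl λ S →
      minor-≡ A (∖-remove S))

module CoalescenceDegrees (H : Graph) (B : V H → Bool) (G : Graph) (r : V G)
  (H! : Unique (verts H)) (simpleG : IsSimple G) (r∈G : r ∈ verts G) where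

  open IsSimple simpleG renaming (unique to G!)
  open ≡.≡-Reasoning

  𝒢 : Graph
  𝒢 = coalesce H B G r

  Bs : List (V H)
  Bs = filterᵇ B (verts H)

  G′ : List (V G)
  G′ = remove (_≟_ G) r (verts G)

  open Copies {V H} G′
  open DecidableLists (_≟_ H) using () renaming (_∈ᵇ_ to _∈ᴴ_)

  Bs! : Unique Bs
  Bs! = Unique.filter⁺ (T? ∘ B) H!

  deg-split : ∀ u → deg G u ≡ (if adj G u r then 1 else 0) ℕ.+ length (filterᵇ (adj G u) G′)
  deg-split u =
    ≡.trans (↭ₚ.↭-length (↭ₚ.filter-↭ (T? ∘ adj G u) (↭-remove (_≟_ G) (verts G) G! r∈G))) (split (adj G u r) ≡.refl)
    where
    split : ∀ t → adj G u r ≡ t →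
      length (filterᵇ (adj G u) (r ∷ G′)) ≡ (if t then 1 else 0) ℕ.+ length (filterᵇ (adj G u) G′)
    split true  uRr = ≡.cong length (List.filter-accept (T? ∘ adj G u) (≡.subst T (≡.sym uRr) tt))
    split false uRr = ≡.cong length (List.filter-reject (T? ∘ adj G u) (≡.subst T uRr))

  deg-r : deg G r ≡ length (filterᵇ (adj G r) G′)
  deg-r = ≡.trans (deg-split r) (≡.cong (λ t → (if t then 1 else 0) ℕ.+ length (filterᵇ (adj G r) G′)) (adj-irr r))

  length-filterᵇ-copy : ∀ (P : V 𝒢 → Bool) b₀ (p : V G → Bool) →
    (∀ b v → P (inj₂ (b , v)) ≡ (eqb H b₀ b ∧ p v)) →
    ∀ b → length (filterᵇ P (copy b)) ≡ (if eqb H b₀ b then length (filterᵇ p G′) else 0)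
  length-filterᵇ-copy P b₀ p P≡ b = begin
    length (filterᵇ P (copy b))                            ≡⟨ length-filterᵇ-map P (λ v → inj₂ (b , v)) G′ ⟩
    length (filterᵇ (λ v → P (inj₂ (b , v))) G′)           ≡⟨ ≡.cong length (filterᵇ-cong (P≡ b) G′) ⟩
    length (filterᵇ (λ v → eqb H b₀ b ∧ p v) G′)           ≡⟨ length-filterᵇ-∧ (eqb H b₀ b) p G′ ⟩
    (if eqb H b₀ b then length (filterᵇ p G′) else 0)      ∎

  length-filterᵇ-copies : ∀ (P : V 𝒢 → Bool) b₀ (p : V G → Bool) →
    (∀ b v → P (inj₂ (b , v)) ≡ (eqb H b₀ b ∧ p v)) →
    ∀ bs → Unique bs → length (filterᵇ P (copies bs)) ≡ (if b₀ ∈ᴴ bs then length (filterᵇ p G′) else 0)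
  length-filterᵇ-copies P b₀ p P≡ []       _            = ≡.refl
  length-filterᵇ-copies P b₀ p P≡ (b ∷ bs) (b∉bs ∷ bs!) = begin
    length (filterᵇ P (copy b ++ copies bs))
      ≡⟨ length-filterᵇ-++ P (copy b) (copies bs) ⟩
    length (filterᵇ P (copy b)) ℕ.+ length (filterᵇ P (copies bs))
      ≡⟨ ≡.cong₂ ℕ._+_ (length-filterᵇ-copy P b₀ p P≡ b) (length-filterᵇ-copies P b₀ p P≡ bs bs!) ⟩
    (if eqb H b₀ b then L else 0) ℕ.+ (if b₀ ∈ᴴ bs then L else 0)
      ≡⟨ at-most-once (_≟_ H b₀ b) ⟩
    (if eqb H b₀ b ∨ b₀ ∈ᴴ bs then L else 0) ∎
    where
    L = length (filterᵇ p G′)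
    at-most-once : ∀ d → (if does d then L else 0) ℕ.+ (if b₀ ∈ᴴ bs then L else 0) ≡
                         (if does d ∨ b₀ ∈ᴴ bs then L else 0)
    at-most-once (yes ≡.refl) rewrite ∈ᵇ-false (_≟_ H) (λ b∈bs → All.lookup b∉bs b∈bs ≡.refl) = ℕₚ.+-identityʳ L
    at-most-once (no _)       = ≡.refl

  deg-root : ∀ h → deg 𝒢 (inj₁ h) ≡ deg H h ℕ.+ (if h ∈ᴴ Bs then deg G r else 0)
  deg-root h = ≡.trans (length-filterᵇ-++ (adj 𝒢 (inj₁ h)) (map inj₁ (verts H)) (copies Bs))
    (≡.cong₂ ℕ._+_ (length-filterᵇ-map (adj 𝒢 (inj₁ h)) inj₁ (verts H))
                   (≡.trans (length-filterᵇ-copies (adj 𝒢 (inj₁ h)) h (adj G r) (λ _ _ → ≡.refl) Bs Bs!)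
                            (≡.cong (λ n → if h ∈ᴴ Bs then n else 0) (≡.sym deg-r))))

  deg-copy : ∀ {b v} → b ∈ Bs → deg 𝒢 (inj₂ (b , v)) ≡ deg G v
  deg-copy {b} {v} b∈Bs = begin
    deg 𝒢 (inj₂ (b , v))
      ≡⟨ length-filterᵇ-++ (adj 𝒢 (inj₂ (b , v))) (map inj₁ (verts H)) (copies Bs) ⟩
    length (filterᵇ (adj 𝒢 (inj₂ (b , v))) (map inj₁ (verts H))) ℕ.+ length (filterᵇ (adj 𝒢 (inj₂ (b , v))) (copies Bs))
      ≡⟨ ≡.cong₂ ℕ._+_ (≡.trans (length-filterᵇ-map _ inj₁ (verts H)) (roots (adj G r v)))
                       (length-filterᵇ-copies (adj 𝒢 (inj₂ (b , v))) b (adj G v) (λ _ _ → ≡.refl) Bs Bs!) ⟩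
    (if adj G r v then 1 else 0) ℕ.+ (if b ∈ᴴ Bs then length (filterᵇ (adj G v) G′) else 0)
      ≡⟨ ≡.cong₂ (λ t t′ → (if t then 1 else 0) ℕ.+ (if t′ then length (filterᵇ (adj G v) G′) else 0))
                 (adj-sym r v) (∈ᵇ-true (_≟_ H) b∈Bs) ⟩
    (if adj G v r then 1 else 0) ℕ.+ length (filterᵇ (adj G v) G′)
      ≡⟨ deg-split v ⟨
    deg G v ∎
    where
    b∈H : b ∈ verts H
    b∈H = proj₁ (∈.∈-filter⁻ (T? ∘ B) {xs = verts H} b∈Bs)
    roots : ∀ t → length (filterᵇ (λ h → eqb H h b ∧ t) (verts H)) ≡ (if t then 1 else 0)
    roots t = begin
      length (filterᵇ (λ h → eqb H h b ∧ t) (verts H))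
        ≡⟨ ≡.cong length (filterᵇ-cong (λ h → ∧-comm (eqb H h b) t) (verts H)) ⟩
      length (filterᵇ (λ h → t ∧ eqb H h b) (verts H))
        ≡⟨ length-filterᵇ-∧ t (λ h → eqb H h b) (verts H) ⟩
      (if t then length (filterᵇ (λ h → eqb H h b) (verts H)) else 0)
        ≡⟨ ≡.cong (if t then_else 0) (length-filterᵇ-≟ (_≟_ H) (verts H) H! b∈H) ⟩
      (if t then 1 else 0) ∎

module CharPoly {c ℓ : Level} (R : CommutativeRing c ℓ) (q x : CommutativeRing.Carrier R) where

  open CommutativeRing R renaming (Carrier to C) hiding (zero)
  open import Relation.Binary.Reasoning.Setoid setoid
  open import Algebra.Properties.Ring ring using (-‿+-comm; [y-z]x≈yx-zx)
  open RingLemmas R using (x-0#≈x)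
  open Minors R
  open SubsetSums R

  charMatrix : (F : Graph) → V F → V F → C
  charMatrix F u v = (if eqb F u v then x else 0#) - Lq R q F u v

  charMatrix-diagonal : ∀ F u → charMatrix F u u ≡ x - q * natR R (deg F u)
  charMatrix-diagonal F u rewrite dec-true (_≟_ F u u) ≡.refl = ≡.refl

  charMatrix-offDiagonal : ∀ F {u v} → u ≢ v → charMatrix F u v ≡ 0# - (if adj F u v then 1# else 0#)
  charMatrix-offDiagonal F {u} {v} u≢v rewrite dec-false (_≟_ F u v) u≢v = ≡.refl

  charPoly≈minor : ∀ F S → Unique (keep F S) → charPoly R q F S x ≈ minor (charMatrix F) (keep F S) (keep F S)
  charPoly≈minor F S ks! = begin
    det R (length ks) (λ i j → (if does (i Fin.≟ j) then x else 0#) - Lq R q F (lookup ks i) (lookup ks j))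
      ≈⟨ det-cong (length ks) (λ i j → reflexive (≡.cong (λ t → (if t then x else 0#) - Lq R q F (lookup ks i) (lookup ks j))
                                                          (does-i≟j i j))) ⟩
    det R (length ks) (λ i j → charMatrix F (lookup ks i) (lookup ks j))
      ≈⟨ det≈minor (length ks) (lookup ks) (lookup ks) (charMatrix F) ⟩
    minor (charMatrix F) (tabulate (lookup ks)) (tabulate (lookup ks))
      ≈⟨ minor-≡ (charMatrix F) (List.tabulate-lookup ks) ⟩
    minor (charMatrix F) ks ks ∎
    where
    ks = keep F S
    does-i≟j : ∀ i j → does (i Fin.≟ j) ≡ eqb F (lookup ks i) (lookup ks j)
    does-i≟j i j = does-⇔ (mk⇔ (≡.cong (lookup ks)) (Unique-lookup-injective ks! i j)) (i Fin.≟ j) (_≟_ F _ _)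

  natR-+ : ∀ m n → natR R (m ℕ.+ n) ≈ natR R m + natR R n
  natR-+ zero    n = sym (+-identityˡ _)
  natR-+ (suc m) n = trans (+-congˡ (natR-+ m n)) (sym (+-assoc _ _ _))

  x-q[m+n]≈[x-qm]+[[x-qn]-x] : ∀ m n → x - q * natR R (m ℕ.+ n) ≈ (x - q * natR R m) + ((x - q * natR R n) - x)
  x-q[m+n]≈[x-qm]+[[x-qn]-x] m n = begin
    x - q * natR R (m ℕ.+ n)    ≈⟨ +-congˡ (-‿cong (trans (*-congˡ (natR-+ m n)) (distribˡ q _ _))) ⟩
    x - (qm + qn)               ≈⟨ +-congˡ (-‿+-comm qm qn) ⟨
    x + (- qm + - qn)           ≈⟨ +-assoc x (- qm) (- qn) ⟨
    (x - qm) + - qn             ≈⟨ +-congˡ (trans (+-congˡ (-‿inverseʳ x)) (+-identityʳ _)) ⟨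
    (x - qm) + (- qn + (x - x)) ≈⟨ +-congˡ (+-assoc (- qn) x (- x)) ⟨
    (x - qm) + ((- qn + x) - x) ≈⟨ +-congˡ (+-congʳ (+-comm (- qn) x)) ⟩
    (x - qm) + ((x - qn) - x)   ∎
    where
    qm = q * natR R m
    qn = q * natR R n

  module Coalescence (H : Graph) (B : V H → Bool) (G : Graph) (r : V G) (T : V H → Bool)
    (H! : Unique (verts H)) (simpleG : IsSimple G) (r∈G : r ∈ verts G)
    (T∩B=∅ : ∀ v → T v ≡ true → B v ≡ false) where

    open IsSimple simpleG renaming (unique to G!)
    open CoalescenceDegrees H B G r H! simpleG r∈G
    open Copies {V H} G′
    open DecidableLists (_≟_ H) using () renaming (_∈ᵇ_ to _∈ᴴ_)

    hs : List (V H)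
    hs = keep H T

    c₀ : C
    c₀ = charMatrix G r r - x

    open CoalescedMinors R (_≟_ H) (_≟_ G) (charMatrix H) (charMatrix G) r G′ (∉-remove (_≟_ G) r (verts G)) c₀

    G′! : Unique G′
    G′! = Unique.filter⁺ (λ v → T? (not (eqb G v r))) G!

    inj₁≢inj₂ : ∀ {h b : V H} {v : V G} → inj₁ h ≢ inj₂ (b , v)
    inj₁≢inj₂ ()

    inj₂≢inj₁ : ∀ {h b : V H} {v : V G} → inj₂ (b , v) ≢ inj₁ h
    inj₂≢inj₁ ()

    if-true : ∀ {t} {a d : C} → t ≡ true → (if t then a else d) ≡ a
    if-true ≡.refl = ≡.refl

    if-false : ∀ {t} {a d : C} → t ≡ false → (if t then a else d) ≡ d
    if-false ≡.refl = ≡.refl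

    indicator-∧ : ∀ t a → 0# - (if t ∧ a then 1# else 0#) ≈ (if t then 0# - (if a then 1# else 0#) else 0#)
    indicator-∧ true  a = refl
    indicator-∧ false a = x-0#≈x 0#

    r≢G′ : ∀ {v} → v ∈ G′ → r ≢ v
    r≢G′ v∈ ≡.refl = ∉-remove (_≟_ G) r (verts G) v∈

    root→copy𝒢 : ∀ h b v → b ∈ Bs → v ∈ G′ →
      charMatrix 𝒢 (inj₁ h) (inj₂ (b , v)) ≈ (if eqb H h b then charMatrix G r v else 0#)
    root→copy𝒢 h b v _ v∈ = begin
      charMatrix 𝒢 (inj₁ h) (inj₂ (b , v))                            ≡⟨ charMatrix-offDiagonal 𝒢 inj₁≢inj₂ ⟩
      0# - (if eqb H h b ∧ adj G r v then 1# else 0#)                   ≈⟨ indicator-∧ (eqb H h b) (adj G r v) ⟩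
      (if eqb H h b then 0# - (if adj G r v then 1# else 0#) else 0#)
        ≡⟨ ≡.cong (if eqb H h b then_else 0#) (≡.sym (charMatrix-offDiagonal G (r≢G′ v∈))) ⟩
      (if eqb H h b then charMatrix G r v else 0#)                      ∎

    copy→root𝒢 : ∀ h b v → b ∈ Bs → v ∈ G′ →
      charMatrix 𝒢 (inj₂ (b , v)) (inj₁ h) ≈ (if eqb H h b then charMatrix G v r else 0#)
    copy→root𝒢 h b v _ v∈ = begin
      charMatrix 𝒢 (inj₂ (b , v)) (inj₁ h)                            ≡⟨ charMatrix-offDiagonal 𝒢 inj₂≢inj₁ ⟩
      0# - (if eqb H h b ∧ adj G r v then 1# else 0#)                   ≈⟨ indicator-∧ (eqb H h b) (adj G r v) ⟩
      (if eqb H h b then 0# - (if adj G r v then 1# else 0#) else 0#)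
        ≡⟨ ≡.cong (λ t → if eqb H h b then 0# - (if t then 1# else 0#) else 0#) (adj-sym r v) ⟩
      (if eqb H h b then 0# - (if adj G v r then 1# else 0#) else 0#)
        ≡⟨ ≡.cong (if eqb H h b then_else 0#) (≡.sym (charMatrix-offDiagonal G (r≢G′ v∈ ∘ ≡.sym))) ⟩
      (if eqb H h b then charMatrix G v r else 0#)                      ∎

    copy→copy𝒢 : ∀ b b′ v v′ → b ∈ Bs → b′ ∈ Bs → v ∈ G′ → v′ ∈ G′ →
      charMatrix 𝒢 (inj₂ (b , v)) (inj₂ (b′ , v′)) ≈ (if eqb H b b′ then charMatrix G v v′ else 0#)
    copy→copy𝒢 b b′ v v′ b∈ _ _ _ = entry (_≟_ H b b′) (_≟_ G v v′)
      where
      entry : Dec (b ≡ b′) → Dec (v ≡ v′) →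
        charMatrix 𝒢 (inj₂ (b , v)) (inj₂ (b′ , v′)) ≈ (if eqb H b b′ then charMatrix G v v′ else 0#)
      entry (yes ≡.refl) (yes ≡.refl) = begin
        charMatrix 𝒢 (inj₂ (b , v)) (inj₂ (b , v))  ≡⟨ charMatrix-diagonal 𝒢 (inj₂ (b , v)) ⟩
        x - q * natR R (deg 𝒢 (inj₂ (b , v)))        ≡⟨ ≡.cong (λ n → x - q * natR R n) (deg-copy b∈) ⟩
        x - q * natR R (deg G v)                      ≡⟨ charMatrix-diagonal G v ⟨
        charMatrix G v v                              ≡⟨ if-true (dec-true (_≟_ H b b) ≡.refl) ⟨
        (if eqb H b b then charMatrix G v v else 0#)  ∎
      entry (yes ≡.refl) (no v≢v′) = begin
        charMatrix 𝒢 (inj₂ (b , v)) (inj₂ (b , v′))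
          ≡⟨ charMatrix-offDiagonal 𝒢 {inj₂ (b , v)} {inj₂ (b , v′)} (λ { ≡.refl → v≢v′ ≡.refl }) ⟩
        0# - (if eqb H b b ∧ adj G v v′ then 1# else 0#)
          ≈⟨ indicator-∧ (eqb H b b) (adj G v v′) ⟩
        (if eqb H b b then 0# - (if adj G v v′ then 1# else 0#) else 0#)
          ≡⟨ ≡.cong (if eqb H b b then_else 0#) (≡.sym (charMatrix-offDiagonal G v≢v′)) ⟩
        (if eqb H b b then charMatrix G v v′ else 0#) ∎
      entry (no b≢b′) _ = begin
        charMatrix 𝒢 (inj₂ (b , v)) (inj₂ (b′ , v′))
          ≡⟨ charMatrix-offDiagonal 𝒢 {inj₂ (b , v)} {inj₂ (b′ , v′)} (λ { ≡.refl → b≢b′ ≡.refl }) ⟩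
        0# - (if eqb H b b′ ∧ adj G v v′ then 1# else 0#)
          ≈⟨ indicator-∧ (eqb H b b′) (adj G v v′) ⟩
        (if eqb H b b′ then 0# - (if adj G v v′ then 1# else 0#) else 0#)
          ≡⟨ if-false (dec-false (_≟_ H b b′) b≢b′) ⟩
        0#
          ≡⟨ if-false (dec-false (_≟_ H b b′) b≢b′) ⟨
        (if eqb H b b′ then charMatrix G v v′ else 0#) ∎

    diagonal𝒢 : ∀ h → h ∈ hs → charMatrix 𝒢 (inj₁ h) (inj₁ h) ≈ charMatrix H h h + (if h ∈ᴴ Bs then c₀ else 0#)
    diagonal𝒢 h _ = begin
      charMatrix 𝒢 (inj₁ h) (inj₁ h)                                      ≡⟨ charMatrix-diagonal 𝒢 (inj₁ h) ⟩
      x - q * natR R (deg 𝒢 (inj₁ h))                                      ≡⟨ ≡.cong (λ n → x - q * natR R n) (deg-root h) ⟩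
      x - q * natR R (deg H h ℕ.+ (if h ∈ᴴ Bs then deg G r else 0))       ≈⟨ attached (h ∈ᴴ Bs) ⟩
      charMatrix H h h + (if h ∈ᴴ Bs then c₀ else 0#)                     ∎
      where
      attached : ∀ t → x - q * natR R (deg H h ℕ.+ (if t then deg G r else 0)) ≈ charMatrix H h h + (if t then c₀ else 0#)
      attached true  = trans (x-q[m+n]≈[x-qm]+[[x-qn]-x] (deg H h) (deg G r))
        (sym (+-cong (reflexive (charMatrix-diagonal H h)) (+-congʳ (reflexive (charMatrix-diagonal G r)))))
      attached false = trans (reflexive (≡.cong (λ n → x - q * natR R n) (ℕₚ.+-identityʳ (deg H h))))
        (sym (trans (+-congʳ (reflexive (charMatrix-diagonal H h))) (+-identityʳ _)))

    offDiagonal𝒢 : ∀ h h′ → h ∈ hs → h′ ∈ hs → h ≢ h′ →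
      charMatrix 𝒢 (inj₁ h) (inj₁ h′) ≈ charMatrix H h h′
    offDiagonal𝒢 h h′ _ _ h≢h′ = reflexive (≡.trans
      (charMatrix-offDiagonal 𝒢 {inj₁ h} {inj₁ h′} (λ { ≡.refl → h≢h′ ≡.refl })) (≡.sym (charMatrix-offDiagonal H h≢h′)))

    Bs⊆hs : ∀ {b} → b ∈ Bs → b ∈ hs
    Bs⊆hs {b} b∈ with ∈.∈-filter⁻ (T? ∘ B) {xs = verts H} b∈
    ... | b∈H , Bb = ∈.∈-filter⁺ (λ v → T? (not (T v))) b∈H (not-T Bb)
      where
      not-T : Data.Bool.T (B b) → Data.Bool.T (not (T b))
      not-T Bb with T b in Tb
      ... | false = tt
      ... | true  = ≡.subst Data.Bool.T (T∩B=∅ b Tb) Bb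

    isCoalesced : IsCoalesced hs Bs (charMatrix 𝒢)
    isCoalesced = record
      { hs-unique   = Unique.filter⁺ (λ v → T? (not (T v))) H!
      ; bs-unique   = Bs!
      ; bs⊆hs       = Bs⊆hs
      ; diagonal    = diagonal𝒢
      ; offDiagonal = offDiagonal𝒢
      ; root→copy   = root→copy𝒢
      ; copy→root   = copy→root𝒢
      ; copy→copy   = copy→copy𝒢
      }

    keep-𝒢 : keep 𝒢 (liftSet H G T) ≡ map inj₁ hs ++ copies Bs
    keep-𝒢 = ≡.trans (List.filter-++ (λ u → T? (not (liftSet H G T u))) (map inj₁ (verts H)) (copies Bs))
                     (≡.cong₂ _++_ (filterᵇ-map _ inj₁ (verts H)) (List.filter-all _ (All.tabulate copy-kept)))
      where
      copy-kept : ∀ {u} → u ∈ copies Bs → Data.Bool.T (not (liftSet H G T u))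
      copy-kept u∈ with ∈-copies⁻ Bs u∈
      ... | _ , _ , _ , _ , ≡.refl = tt

    keep-𝒢-unique : Unique (keep 𝒢 (liftSet H G T))
    keep-𝒢-unique = ≡.subst Unique (≡.sym keep-𝒢)
      (Unique.++⁺ (Unique.map⁺ (λ { ≡.refl → ≡.refl }) (IsCoalesced.hs-unique isCoalesced))
                  (copies-unique G′! Bs Bs!) roots∩copies=∅)
      where
      roots∩copies=∅ : ∀ {u} → u ∈ map inj₁ hs × u ∈ copies Bs → ⊥
      roots∩copies=∅ (u∈roots , u∈copies) with ∈.∈-map⁻ inj₁ u∈roots | ∈-copies⁻ Bs u∈copies
      ... | _ , _ , ≡.refl | _ , _ , _ , _ , ()

    pGr pG : C
    pGr = charPoly R q G (eqb G r) x
    pG  = charPoly R q G (λ _ → false) x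

    pGr≈p₀ : pGr ≈ p₀
    pGr≈p₀ = trans (charPoly≈minor G (eqb G r) (Unique.filter⁺ (λ v → T? (not (eqb G r v))) G!))
                   (minor-≡ (charMatrix G) (filterᵇ-cong (λ v → ≡.cong not (does-≟-sym (_≟_ G) r v)) (verts G)))

    pG≈ : pG ≈ charMatrix G r r * p₀ + border (charMatrix G) r G′
    pG≈ = trans (charPoly≈minor G (λ _ → false) (Unique.filter⁺ (λ _ → T? true) G!))
                (trans (minor-≡ (charMatrix G) (List.filter-all (λ _ → T? true) (All.universal (λ _ → tt) (verts G))))
                (trans (minor-↭ (charMatrix G) (↭-remove (_≟_ G) (verts G) G! r∈G))
                       (minor-∷ (charMatrix G) r G′)))

    p₁≈pG-x*pGr : p₁ ≈ pG - x * pGr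
    p₁≈pG-x*pGr = sym (begin
      pG - x * pGr                                        ≈⟨ +-cong pG≈ (-‿cong (*-congˡ pGr≈p₀)) ⟩
      (charMatrix G r r * p₀ + border (charMatrix G) r G′) - x * p₀ ≈⟨ +-congʳ (+-comm _ _) ⟩
      (border (charMatrix G) r G′ + charMatrix G r r * p₀) - x * p₀ ≈⟨ +-assoc _ _ _ ⟩
      border (charMatrix G) r G′ + (charMatrix G r r * p₀ - x * p₀) ≈⟨ +-congˡ ([y-z]x≈yx-zx p₀ (charMatrix G r r) x) ⟨
      p₁                                                  ∎)

    charPoly-H : List (V H) → C
    charPoly-H S = charPoly R q H (λ v → Data.Bool.ListAction.any (eqb H v) S ∨ T v) x

    charPoly-H≈minorWithout : ∀ S → charPoly-H S ≈ minorWithout hs S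
    charPoly-H≈minorWithout S =
      trans (charPoly≈minor H _ (Unique.filter⁺ (λ v → T? (not (v ∈ᴴ S ∨ T v))) H!)) (minor-≡ (charMatrix H) keep≡)
      where
      keep≡ : keep H (λ v → v ∈ᴴ S ∨ T v) ≡ hs ∖ S
      keep≡ = ≡.trans (filterᵇ-cong {q = λ v → not (T v) ∧ not (v ∈ᴴ S)}
                                    (λ v → ≡.trans (not-∨ (v ∈ᴴ S) (T v)) (∧-comm (not (v ∈ᴴ S)) (not (T v)))) (verts H))
                      (≡.sym (filterᵇ-filterᵇ (λ v → not (v ∈ᴴ S)) (λ v → not (T v)) (verts H)))

    charPoly-coalesce : charPoly R q 𝒢 (liftSet H G T) x ≈ theorem3RHS R q H B G r T x
    charPoly-coalesce = begin
      charPoly R q 𝒢 (liftSet H G T) x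
        ≈⟨ charPoly≈minor 𝒢 (liftSet H G T) keep-𝒢-unique ⟩
      minor (charMatrix 𝒢) (keep 𝒢 (liftSet H G T)) (keep 𝒢 (liftSet H G T))
        ≈⟨ minor-≡ (charMatrix 𝒢) keep-𝒢 ⟩
      minor (charMatrix 𝒢) (map inj₁ hs ++ copies Bs) (map inj₁ hs ++ copies Bs)
        ≈⟨ minor-coalesced Bs hs (charMatrix 𝒢) isCoalesced ⟩
      subsetSum p₀ p₁ Bs (minorWithout hs)
        ≈⟨ subsetSum-cong Bs _ _ (sym pGr≈p₀) p₁≈pG-x*pGr (λ S → sym (charPoly-H≈minorWithout S)) ⟩
      subsetSum pGr (pG - x * pGr) Bs charPoly-H
        ≈⟨ subsetSum-byCardinality pGr (pG - x * pGr) Bs charPoly-H ⟩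
      theorem3RHS R q H B G r T x ∎

-- B and T enter only through filters of verts H.
theorem3 : {c ℓ : Level} (R : CommutativeRing c ℓ) (q x : CommutativeRing.Carrier R)
    (H : Graph) (B : V H → Bool) (G : Graph) (r : V G) (T : V H → Bool) →
    IsSimple H → IsSimple G → r ∈ verts G →
    (∀ v → B v ≡ true → v ∈ verts H) →
    (∀ v → T v ≡ true → v ∈ verts H) →
    (∀ v → T v ≡ true → B v ≡ false) →
    CommutativeRing._≈_ R
      (charPoly R q (coalesce H B G r) (liftSet H G T) x)
      (theorem3RHS R q H B G r T x)
theorem3 R q x H B G r T simpleH simpleG r∈G _ _ T∩B=∅ =
  CharPoly.Coalescence.charPoly-coalesce R q x H B G r T (IsSimple.unique simpleH) simpleG r∈G T∩B=∅
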